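{- Let $G$ be a finite additive abelian group and $\Sigma=(\Gamma,\sigma)$ a signed graph with underlying graph $\Gamma=(V,E)$. The number of $G$-flows of $\Sigma$ equals $$|G|^{|E|-|V|+k_b(\Sigma)}\Big(\frac{|G|}{|2G|}\Big)^{k_u(\Sigma)}.$$
   Context: A signed graph $\Sigma=(\Gamma,\sigma)$: finite graph $\Gamma=(V,E)$ (loops, multiple edges allowed), $\sigma:E\to\{ -1,1\}$. A cycle (loops included) is balanced if the product of its edge signs is $1$, unbalanced otherwise. $k_b(\Sigma)$, $k_u(\Sigma)$: numbers of connected components with all cycles balanced, resp. containing an unbalanced cycle. Each edge $e$ with endpoints $u,v$ has half-edges $(u,e),(v,e)$ (two half-edges at $v$ for a loop at $v$). An orientation $\omega$ assigns $\pm1$ to each half-edge, compatible with $\sigma$ if $\sigma(e)=-\omega(u,e)\omega(v,e)$ for each edge. A $G$-flow of $\Sigma$ is $f:E\to G$ such that, for a fixed orientation $\omega$ compatible with $\sigma$, at every vertex $v$, $\sum\omega(v,e)f(e)=0$ over all half-edges $(v,e)$ at $v$ (a loop contributes two terms); the count does not depend on the choice of $\omega$. $2G=\{x+x:x\in G\}$. -}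

module Defs where

open import Level using (Level; 0ℓ; _⊔_)
open import Data.Nat using (ℕ; zero; suc)
open import Data.Fin using (Fin; zero; suc; inject₁; fromℕ)
open import Data.Fin.Properties using (_≟_)
open import Data.Bool using (Bool; true; false)
open import Data.Sign using (Sign; opposite) renaming (_*_ to _·_)
open import Data.Product using (Σ; Σ-syntax; ∃; _×_; _,_; proj₁; proj₂)
open import Data.Sum using (_⊎_; inj₁; inj₂)
open import Relation.Nullary using (¬_; yes; no)
open import Relation.Binary using (Setoid; Rel)
open import Relation.Binary.PropositionalEquality as ≡ using (_≡_)
import Relation.Binary.Construct.On as On
open import Relation.Binary.Construct.Closure.ReflexiveTransitive
  using (Star; _◅◅_; reverse) renaming (ε to ε*)
open import Algebra.Bundles using (AbelianGroup)
open import Function.Bundles using (Inverse)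
open import Function.Definitions using (Injective)

HasCard : ∀ {a ℓ} → Setoid a ℓ → ℕ → Set _
HasCard S k = Inverse S (≡.setoid (Fin k))

-- Signed graphs with vertex set Fin n and edge set Fin m.
-- Edge e has two half-edges (e , false) and (e , true), with end
-- vertices  end e false  and  end e true  (equal for a loop).
record SignedGraph (n m : ℕ) : Set where
  field
    end  : Fin m → Bool → Fin n
    sign : Fin m → Sign

module _ {n m : ℕ} (Γ : SignedGraph n m) where
  open SignedGraph Γ

  Joins : Fin m → Fin n → Fin n → Set
  Joins e a b = (end e false ≡ a × end e true ≡ b)
              ⊎ (end e false ≡ b × end e true ≡ a)

  Adj : Rel (Fin n) 0ℓ
  Adj a b = ∃ λ e → Joins e a b

  Adj-sym : ∀ {a b} → Adj a b → Adj b a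
  Adj-sym (e , inj₁ (p , q)) = e , inj₂ (p , q)
  Adj-sym (e , inj₂ (p , q)) = e , inj₁ (p , q)

  Connected : Rel (Fin n) 0ℓ
  Connected = Star Adj

  ConnectedSetoid : Setoid 0ℓ 0ℓ
  ConnectedSetoid = record
    { Carrier = Fin n
    ; _≈_ = Connected
    ; isEquivalence = record
      { refl = ε* ; sym = reverse Adj-sym ; trans = _◅◅_ } }

  -- A cycle of length suc k: distinct vertices vs 0 … vs k and distinct
  -- edges es 0 … es k, where es i joins vs i and vs (i+1), and es k
  -- joins vs k and vs 0.  (Length 1 = loop, length 2 = pair of
  -- parallel edges.)
  record Cycle (k : ℕ) : Set where
    field
      vs     : Fin (suc k) → Fin n
      es     : Fin (suc k) → Fin m
      vs-inj : Injective _≡_ _≡_ vs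
      es-inj : Injective _≡_ _≡_ es
      step   : ∀ (i : Fin k) → Joins (es (inject₁ i)) (vs (inject₁ i)) (vs (suc i))
      close  : Joins (es (fromℕ k)) (vs (fromℕ k)) (vs zero)

  prodSign : ∀ {k} → (Fin k → Sign) → Sign
  prodSign {zero}  s = Sign.+
  prodSign {suc k} s = s zero · prodSign (λ i → s (suc i))

  Balanced : ∀ {k} → Cycle k → Set
  Balanced C = prodSign (λ i → sign (Cycle.es C i)) ≡ Sign.+

  BalancedComp : Fin n → Set
  BalancedComp v = ∀ k (C : Cycle k) → Connected v (Cycle.vs C zero) → Balanced C

  UnbalancedComp : Fin n → Set
  UnbalancedComp v = Σ[ k ∈ ℕ ] Σ[ C ∈ Cycle k ]
                       (Connected v (Cycle.vs C zero) × ¬ Balanced C)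

  BalancedComps : Setoid 0ℓ 0ℓ
  BalancedComps = On.setoid ConnectedSetoid (proj₁ {B = BalancedComp})

  UnbalancedComps : Setoid 0ℓ 0ℓ
  UnbalancedComps = On.setoid ConnectedSetoid (proj₁ {B = UnbalancedComp})

  Orientation : Set
  Orientation = Fin m → Bool → Sign

  Compatible : Orientation → Set
  Compatible ω = ∀ e → sign e ≡ opposite (ω e false · ω e true)

module _ {c ℓ} (G : AbelianGroup c ℓ) where
  open AbelianGroup G

  sumG : ∀ {k} → (Fin k → Carrier) → Carrier
  sumG {zero}  f = ε
  sumG {suc k} f = f zero ∙ sumG (λ i → f (suc i))

  _⊙_ : Sign → Carrier → Carrier
  Sign.+ ⊙ x = x
  Sign.- ⊙ x = x ⁻¹

  TwoG : Setoid (c ⊔ ℓ) ℓ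
  TwoG = On.setoid setoid (proj₁ {B = λ y → ∃ λ x → x ∙ x ≈ y})

  module _ {n m : ℕ} (Γ : SignedGraph n m) (ω : Orientation Γ) where
    open SignedGraph Γ

    halfTerm : (Fin m → Carrier) → Fin n → Fin m → Bool → Carrier
    halfTerm f v e b with end e b ≟ v
    ... | yes _ = ω e b ⊙ f e
    ... | no  _ = ε

    IsFlow : (Fin m → Carrier) → Set ℓ
    IsFlow f = ∀ (v : Fin n) →
      sumG (λ e → halfTerm f v e false ∙ halfTerm f v e true) ≈ ε

    FlowSetoid : Setoid (c ⊔ ℓ) ℓ
    FlowSetoid = record
      { Carrier = Σ (Fin m → Carrier) IsFlow
      ; _≈_ = λ f g → ∀ e → proj₁ f e ≈ proj₁ g e
      ; isEquivalence = record
        { refl = λ e → refl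
        ; sym = λ p e → sym (p e)
        ; trans = λ p q e → trans (p e) (q e) } }

-- Induction on the number of edges.  A non-loop edge e₀ with ends a ≠ b is first made positive by
-- switching at b, which multiplies the flow condition at each vertex by a sign and changes the sign
-- of no cycle.  Contracting the positive edge e₀ then removes one vertex and one edge; it is a
-- bijection on flows, the value on e₀ being forced by the condition at a, and it matches balanced
-- and unbalanced components, since a balancing switching of the contraction lifts to the graph and
-- an unbalanced cycle lifts to an unbalanced cycle, closed up by e₀ if necessary.
-- When only loops remain, every vertex is a component.  A positive loop does not enter the flow
-- condition, and a negative loop enters it through twice its value; so at a vertex with negative
-- loops all but one of them carry arbitrary values and the last one ranges over
-- G[2] = {x | x + x = 0}.  This gives |G|^(|E| - k_u) · |G[2]|^k_u flows with k_b + k_u = |V|,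
-- and |G| = |G[2]| · |2G| turns it into the formula.

module Submission where

open import Defs
open import Data.Nat using (ℕ; _+_; _*_; _^_)
open import Relation.Binary.PropositionalEquality using (_≡_)
open import Algebra.Bundles using (AbelianGroup)
open import Data.Nat using (suc)
open import Data.Bool using (false; true)
open import Data.Fin using (Fin)
open import Data.Sign using (Sign)
open import Relation.Binary.PropositionalEquality using (_≢_)
open import Data.Product using (proj₂)

module Cardinality where

  open import Level using (Level; _⊔_; 0ℓ)
  open import Data.Nat using (zero; suc)
  open import Data.Nat.Properties using (+-suc)
  open import Data.Fin using (Fin; zero; suc)
  open import Data.Fin.Properties using (cantor-schröder-bernstein; *↔×; suc-injective)
  open import Data.Product using (Σ; ∃; _,_; proj₁; proj₂)
  open import Data.Product.Relation.Binary.Pointwise.NonDependent using (_×ₛ_; Pointwise-≡↔≡)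
  open import Data.Product.Function.NonDependent.Setoid using (_×-inverse_)
  open import Data.Sum using (_⊎_; [_,_]′; map₂)
  open import Function.Base using (id)
  open import Data.Empty using (⊥-elim)
  open import Relation.Nullary using (¬_; yes; no; ¬?)
  open import Relation.Unary using (Decidable)
  open import Relation.Binary using (Setoid)
  open import Relation.Binary.PropositionalEquality as ≡ using (refl; cong)
  import Relation.Binary.Construct.On as On
  open import Function.Bundles using (Inverse; Injection)
  open import Function.Definitions using (Injective)
  open import Function.Properties.Inverse using (Inverse⇒Injection)
  import Function.Construct.Composition as Comp
  import Function.Construct.Symmetry as Sym

  private variable
    a b ℓ ℓ′ p q : Level
    k x y : ℕ

  HasCard-unique : {A : Setoid a ℓ} → HasCard A x → HasCard A y → x ≡ y
  HasCard-unique {x = x} {y = y} I J = cantor-schröder-bernstein (injective K) (injective (Sym.inverse K))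
    where
    K : Inverse (≡.setoid (Fin x)) (≡.setoid (Fin y))
    K = Comp.inverse (Sym.inverse I) J
    injective : ∀ {m n} (L : Inverse (≡.setoid (Fin m)) (≡.setoid (Fin n))) → Injective _≡_ _≡_ (Inverse.to L)
    injective L = Injection.injective (Inverse⇒Injection L)

  HasCard-× : {A : Setoid a ℓ} {B : Setoid b ℓ′} → HasCard A x → HasCard B y → HasCard (A ×ₛ B) (x * y)
  HasCard-× I J = Comp.inverse (I ×-inverse J) (Comp.inverse Pointwise-≡↔≡ (Sym.inverse *↔×))

  Subsetoid : (S : Setoid a ℓ) → (Setoid.Carrier S → Set p) → Setoid (a ⊔ p) ℓ
  Subsetoid S P = On.setoid S (proj₁ {B = P})

  count : {P : Fin k → Set p} → Decidable P → ℕ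
  count {zero}  P? = 0
  count {suc k} P? with P? zero
  ... | yes _ = suc (count (λ i → P? (suc i)))
  ... | no  _ = count (λ i → P? (suc i))

  FinSubsetoid : (k : ℕ) → (Fin k → Set p) → Setoid p 0ℓ
  FinSubsetoid k = Subsetoid (≡.setoid (Fin k))

  module _ {P : Fin (suc k) → Set p} {c : ℕ}
           (I : HasCard (FinSubsetoid k (λ i → P (suc i))) c) where
    private module I = Inverse I

    HasCard-FinSubsetoid-∈ : P zero → HasCard (FinSubsetoid (suc k) P) (suc c)
    HasCard-FinSubsetoid-∈ p₀ = record
      { to = to ; from = from ; to-cong = to-cong ; from-cong = λ { refl → refl }
      ; inverse = inverseˡ , inverseʳ }
      where
      to : Σ (Fin (suc k)) P → Fin (suc c)
      to (zero  , _) = zero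
      to (suc i , q) = suc (I.to (i , q))
      from : Fin (suc c) → Σ (Fin (suc k)) P
      from zero    = zero , p₀
      from (suc j) = suc (proj₁ (I.from j)) , proj₂ (I.from j)
      to-cong : ∀ {x y} → proj₁ x ≡ proj₁ y → to x ≡ to y
      to-cong {zero  , _} {zero , _} refl = refl
      to-cong {suc i , _} {suc _ , _} refl = cong suc (I.to-cong refl)
      inverseˡ : ∀ {j x} → proj₁ x ≡ proj₁ (from j) → to x ≡ j
      inverseˡ {zero}  {zero  , _} refl = refl
      inverseˡ {suc j} {suc i , _} eq = cong suc (I.inverseˡ (suc-injective eq))
      inverseʳ : ∀ {x j} → j ≡ to x → proj₁ (from j) ≡ proj₁ x
      inverseʳ {zero  , _} refl = refl
      inverseʳ {suc i , _} refl = cong suc (I.inverseʳ refl)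

    HasCard-FinSubsetoid-∉ : ¬ P zero → HasCard (FinSubsetoid (suc k) P) c
    HasCard-FinSubsetoid-∉ ¬p₀ = record
      { to = to ; from = from ; to-cong = to-cong ; from-cong = λ { refl → refl }
      ; inverse = inverseˡ , inverseʳ }
      where
      to : Σ (Fin (suc k)) P → Fin c
      to (zero  , p₀) = ⊥-elim (¬p₀ p₀)
      to (suc i , q) = I.to (i , q)
      from : Fin c → Σ (Fin (suc k)) P
      from j = suc (proj₁ (I.from j)) , proj₂ (I.from j)
      to-cong : ∀ {x y} → proj₁ x ≡ proj₁ y → to x ≡ to y
      to-cong {zero  , p₀} refl = ⊥-elim (¬p₀ p₀)
      to-cong {suc i , _} {suc _ , _} refl = I.to-cong refl
      inverseˡ : ∀ {j x} → proj₁ x ≡ proj₁ (from j) → to x ≡ j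
      inverseˡ {x = suc i , _} eq = I.inverseˡ (suc-injective eq)
      inverseʳ : ∀ {x j} → j ≡ to x → proj₁ (from j) ≡ proj₁ x
      inverseʳ {zero  , p₀} refl = ⊥-elim (¬p₀ p₀)
      inverseʳ {suc i , _} refl = cong suc (I.inverseʳ refl)

  HasCard-FinSubsetoid-∅ : {P : Fin 0 → Set p} → HasCard (FinSubsetoid 0 P) 0
  HasCard-FinSubsetoid-∅ = record
    { to = λ { (() , _) } ; from = λ () ; to-cong = λ { {() , _} } ; from-cong = λ { {()} }
    ; inverse = (λ { {()} }) , λ { {() , _} } }

  HasCard-count : {P : Fin k → Set p} (P? : Decidable P) → HasCard (FinSubsetoid k P) (count P?)
  HasCard-count {zero}  P? = HasCard-FinSubsetoid-∅
  HasCard-count {suc k} P? with P? zero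
  ... | yes p₀ = HasCard-FinSubsetoid-∈ (HasCard-count (λ i → P? (suc i))) p₀
  ... | no ¬p₀ = HasCard-FinSubsetoid-∉ (HasCard-count (λ i → P? (suc i))) ¬p₀

  HasCard-Subsetoid : {S : Setoid a ℓ} {P : Setoid.Carrier S → Set p} →
                      (∀ {x y} → Setoid._≈_ S x y → P x → P y) → Decidable P →
                      HasCard S k → ∃ (HasCard (Subsetoid S P))
  HasCard-Subsetoid {k = k} {S = S} {P} resp P? I = _ , Comp.inverse restrict (HasCard-count (λ i → P? (I.from i)))
    where
    module I = Inverse I
    restrict : Inverse (Subsetoid S P) (FinSubsetoid k (λ i → P (I.from i)))
    restrict = record
      { to = λ { (x , q) → I.to x , resp (Setoid.sym S (I.inverseʳ refl)) q }
      ; from = λ { (i , q) → I.from i , q }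
      ; to-cong = I.to-cong ; from-cong = I.from-cong
      ; inverse = I.inverseˡ , I.inverseʳ }

  count-cong : {P : Fin k → Set p} {Q : Fin k → Set q} (P? : Decidable P) (Q? : Decidable Q) →
               (∀ i → P i → Q i) → (∀ i → Q i → P i) → count P? ≡ count Q?
  count-cong {zero}  P? Q? P⊆Q Q⊆P = refl
  count-cong {suc k} P? Q? P⊆Q Q⊆P with P? zero | Q? zero
  ... | yes _  | yes _  = cong suc (count-cong _ _ (λ i → P⊆Q (suc i)) (λ i → Q⊆P (suc i)))
  ... | yes p  | no ¬q  = ⊥-elim (¬q (P⊆Q zero p))
  ... | no ¬p  | yes q  = ⊥-elim (¬p (Q⊆P zero q))
  ... | no _   | no _   = count-cong _ _ (λ i → P⊆Q (suc i)) (λ i → Q⊆P (suc i))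

  count-+-∁ : {P : Fin k → Set p} (P? : Decidable P) → count P? + count (λ i → ¬? (P? i)) ≡ k
  count-+-∁ {zero}  P? = refl
  count-+-∁ {suc k} P? with P? zero
  ... | yes _ = cong suc (count-+-∁ (λ i → P? (suc i)))
  ... | no  _ = ≡.trans (+-suc _ _) (cong suc (count-+-∁ (λ i → P? (suc i))))

  count-∅ : {P : Fin k → Set p} (P? : Decidable P) → (∀ i → ¬ P i) → count P? ≡ 0
  count-∅ {zero}  P? ∅ = refl
  count-∅ {suc k} P? ∅ with P? zero
  ... | yes p = ⊥-elim (∅ zero p)
  ... | no  _ = count-∅ (λ i → P? (suc i)) (λ i → ∅ (suc i))

  count-insert : {P : Fin k → Set p} {Q : Fin k → Set q} (P? : Decidable P) (Q? : Decidable Q) (v : Fin k) →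
                 (∀ i → P i → Q i ⊎ i ≡ v) → (∀ i → Q i → P i) → P v → ¬ Q v →
                 count P? ≡ suc (count Q?)
  count-insert {suc k} P? Q? zero P⊆Q+v Q⊆P pv ¬qv with P? zero | Q? zero
  ... | _      | yes q₀ = ⊥-elim (¬qv q₀)
  ... | no ¬p₀ | no _   = ⊥-elim (¬p₀ pv)
  ... | yes _  | no _   =
    cong suc (count-cong _ _ (λ i p → [ id , (λ ()) ]′ (P⊆Q+v (suc i) p)) (λ i → Q⊆P (suc i)))
  count-insert {suc k} P? Q? (suc v) P⊆Q+v Q⊆P pv ¬qv with P? zero | Q? zero
  ... | yes _  | yes _  =
    cong suc (count-insert _ _ v (λ i p → map₂ suc-injective (P⊆Q+v (suc i) p)) (λ i → Q⊆P (suc i)) pv ¬qv)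
  ... | no _   | no _   =
    count-insert _ _ v (λ i p → map₂ suc-injective (P⊆Q+v (suc i) p)) (λ i → Q⊆P (suc i)) pv ¬qv
  ... | no ¬p₀ | yes q₀ = ⊥-elim (¬p₀ (Q⊆P zero q₀))
  ... | yes p₀ | no ¬q₀ = ⊥-elim ([ ¬q₀ , (λ ()) ]′ (P⊆Q+v zero p₀))

  first : {P : Fin k → Set p} → Decidable P → ∃ P → Fin k
  first {zero}  P? (() , _)
  first {suc k} {P = P} P? ∃p with P? zero
  ... | yes _  = zero
  ... | no ¬p₀ = suc (first (λ i → P? (suc i)) (tail ∃p))
    where
    tail : ∃ P → ∃ (λ i → P (suc i))
    tail (zero  , p₀) = ⊥-elim (¬p₀ p₀)
    tail (suc i , p)  = i , p

  first-satisfies : {P : Fin k → Set p} (P? : Decidable P) (∃p : ∃ P) → P (first P? ∃p)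
  first-satisfies {zero}  P? (() , _)
  first-satisfies {suc k} P? ∃p with P? zero
  ... | yes p₀ = p₀
  ... | no  _  = first-satisfies (λ i → P? (suc i)) _

  first-cong : {P : Fin k → Set p} {Q : Fin k → Set q} (P? : Decidable P) (Q? : Decidable Q) (∃p : ∃ P) (∃q : ∃ Q) →
               (∀ i → P i → Q i) → (∀ i → Q i → P i) → first P? ∃p ≡ first Q? ∃q
  first-cong {zero}  P? Q? (() , _) ∃q P⊆Q Q⊆P
  first-cong {suc k} P? Q? ∃p ∃q P⊆Q Q⊆P with P? zero | Q? zero
  ... | yes _  | yes _  = refl
  ... | yes p₀ | no ¬q₀ = ⊥-elim (¬q₀ (P⊆Q zero p₀))
  ... | no ¬p₀ | yes q₀ = ⊥-elim (¬p₀ (Q⊆P zero q₀))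
  ... | no _   | no _   = cong suc (first-cong _ _ _ _ (λ i → P⊆Q (suc i)) (λ i → Q⊆P (suc i)))

module GroupSums {c ℓ} (G : AbelianGroup c ℓ) where

  open import Level using (_⊔_)
  open import Relation.Binary using (Setoid)
  open import Data.Nat using (zero; suc)
  open import Data.Fin using (Fin; zero; suc; punchIn)
  open import Data.Fin.Properties using (_≟_; suc-injective)
  open import Data.Sign using (Sign; opposite) renaming (_*_ to _·_)
  open import Relation.Nullary using (¬_; Dec; yes; no)
  open import Relation.Binary.PropositionalEquality as ≡ using ()
  open import Data.Empty using (⊥-elim)
  open import Data.Sum using (_⊎_; [_,_]′)
  open import Function.Base using (_∘_)
  open AbelianGroup G
  open import Algebra.Properties.AbelianGroup G using (⁻¹-∙-comm; ε⁻¹≈ε; ⁻¹-involutive; inverseˡ-unique)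
  open import Algebra.Properties.CommutativeSemigroup commutativeSemigroup using (interchange)
  open import Relation.Binary.Reasoning.Setoid setoid

  infixr 8 _⊛_
  _⊛_ : Sign → Carrier → Carrier
  _⊛_ = _⊙_ G

  ⊛-cong : ∀ s {x y} → x ≈ y → s ⊛ x ≈ s ⊛ y
  ⊛-cong Sign.+ x≈y = x≈y
  ⊛-cong Sign.- x≈y = ⁻¹-cong x≈y

  ⊛-ε : ∀ s → s ⊛ ε ≈ ε
  ⊛-ε Sign.+ = refl
  ⊛-ε Sign.- = ε⁻¹≈ε

  ⊛-∙ : ∀ s x y → s ⊛ x ∙ s ⊛ y ≈ s ⊛ (x ∙ y)
  ⊛-∙ Sign.+ x y = refl
  ⊛-∙ Sign.- x y = ⁻¹-∙-comm x y

  ⊛-· : ∀ s t x → (s · t) ⊛ x ≈ s ⊛ t ⊛ x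
  ⊛-· Sign.+ t       x = refl
  ⊛-· Sign.- Sign.+ x = refl
  ⊛-· Sign.- Sign.- x = sym (⁻¹-involutive x)

  ⊛-involutive : ∀ s x → s ⊛ s ⊛ x ≈ x
  ⊛-involutive Sign.+ x = refl
  ⊛-involutive Sign.- x = ⁻¹-involutive x

  ⊛≈ε⇒≈ε : ∀ s {x} → s ⊛ x ≈ ε → x ≈ ε
  ⊛≈ε⇒≈ε s {x} sx≈ε = begin
    x         ≈⟨ ⊛-involutive s x ⟨
    s ⊛ s ⊛ x ≈⟨ ⊛-cong s sx≈ε ⟩
    s ⊛ ε     ≈⟨ ⊛-ε s ⟩
    ε         ∎

  opposite-⊛-inverse : ∀ s x → opposite s ⊛ x ∙ s ⊛ x ≈ ε
  opposite-⊛-inverse Sign.+ x = inverseˡ x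
  opposite-⊛-inverse Sign.- x = trans (∙-congʳ (sym (⁻¹-involutive x))) (inverseˡ (x ⁻¹))

  ⊛-inverseˡ-unique : ∀ s {x r} → s ⊛ x ∙ r ≈ ε → x ≈ s ⊛ (r ⁻¹)
  ⊛-inverseˡ-unique s {x} {r} sx+r≈ε = begin
    x         ≈⟨ ⊛-involutive s x ⟨
    s ⊛ s ⊛ x ≈⟨ ⊛-cong s (inverseˡ-unique (s ⊛ x) r sx+r≈ε) ⟩
    s ⊛ (r ⁻¹)  ∎

  ⊛-involutive-inverseˡ : ∀ s r → s ⊛ s ⊛ (r ⁻¹) ∙ r ≈ ε
  ⊛-involutive-inverseˡ s r = trans (∙-congʳ (⊛-involutive s (r ⁻¹))) (inverseˡ r)

  ∙-cancel-ε : ∀ {x y} → x ∙ y ≈ ε → x ≈ ε → y ≈ ε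
  ∙-cancel-ε {x} {y} x+y≈ε x≈ε = begin
    y     ≈⟨ identityˡ y ⟨
    ε ∙ y ≈⟨ ∙-congʳ x≈ε ⟨
    x ∙ y ≈⟨ x+y≈ε ⟩
    ε     ∎

  TwoTorsion : Setoid (c ⊔ ℓ) ℓ
  TwoTorsion = Cardinality.Subsetoid setoid (λ x → x ∙ x ≈ ε)

  ∑ : ∀ {k} → (Fin k → Carrier) → Carrier
  ∑ = sumG G

  ∑-cong : ∀ {k} {f g : Fin k → Carrier} → (∀ i → f i ≈ g i) → ∑ f ≈ ∑ g
  ∑-cong {zero}  f≈g = refl
  ∑-cong {suc k} f≈g = ∙-cong (f≈g zero) (∑-cong (λ i → f≈g (suc i)))

  ∑-∙ : ∀ {k} (f g : Fin k → Carrier) → ∑ (λ i → f i ∙ g i) ≈ ∑ f ∙ ∑ g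
  ∑-∙ {zero}  f g = sym (identityˡ ε)
  ∑-∙ {suc k} f g = trans (∙-congˡ (∑-∙ (λ i → f (suc i)) (λ i → g (suc i)))) (interchange _ _ _ _)

  ∑-⊛ : ∀ {k} s (f : Fin k → Carrier) → ∑ (λ i → s ⊛ f i) ≈ s ⊛ ∑ f
  ∑-⊛ {zero}  s f = sym (⊛-ε s)
  ∑-⊛ {suc k} s f = trans (∙-congˡ (∑-⊛ s (λ i → f (suc i)))) (⊛-∙ s _ _)

  ∑-ε : ∀ {k} (f : Fin k → Carrier) → (∀ i → f i ≈ ε) → ∑ f ≈ ε
  ∑-ε {zero}  f f≈ε = refl
  ∑-ε {suc k} f f≈ε = trans (∙-cong (f≈ε zero) (∑-ε _ (λ i → f≈ε (suc i)))) (identityˡ ε)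

  ∑-single : ∀ {k} (j : Fin k) (f : Fin k → Carrier) → (∀ i → ¬ i ≡ j → f i ≈ ε) → ∑ f ≈ f j
  ∑-single zero    f f≈ε = trans (∙-congˡ (∑-ε _ (λ i → f≈ε (suc i) (λ ())))) (identityʳ _)
  ∑-single (suc j) f f≈ε = begin
    f zero ∙ ∑ (λ i → f (suc i)) ≈⟨ ∙-congʳ (f≈ε zero (λ ())) ⟩
    ε ∙ ∑ (λ i → f (suc i))      ≈⟨ identityˡ _ ⟩
    ∑ (λ i → f (suc i))          ≈⟨ ∑-single j _ (λ i i≢j → f≈ε (suc i) (λ eq → i≢j (suc-injective eq))) ⟩
    f (suc j)                    ∎

  ∑-punchIn : ∀ {k} (j : Fin (suc k)) (f : Fin (suc k) → Carrier) → ∑ f ≈ f j ∙ ∑ (λ i → f (punchIn j i))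
  ∑-punchIn zero f = refl
  ∑-punchIn {suc k} (suc j) f = begin
    f zero ∙ ∑ (λ i → f (suc i))                               ≈⟨ ∙-congˡ (∑-punchIn j (λ i → f (suc i))) ⟩
    f zero ∙ (f (suc j) ∙ ∑ (λ i → f (suc (punchIn j i))))     ≈⟨ assoc _ _ _ ⟨
    (f zero ∙ f (suc j)) ∙ ∑ (λ i → f (suc (punchIn j i)))     ≈⟨ ∙-congʳ (comm _ _) ⟩
    (f (suc j) ∙ f zero) ∙ ∑ (λ i → f (suc (punchIn j i)))     ≈⟨ assoc _ _ _ ⟩
    f (suc j) ∙ (f zero ∙ ∑ (λ i → f (suc (punchIn j i))))     ∎

  onlyAt : ∀ {k} → Fin k → Fin k → Carrier → Carrier
  onlyAt x v c with x ≟ v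
  ... | yes _ = c
  ... | no  _ = ε

  onlyAt-≡ : ∀ {k} {x v : Fin k} c → x ≡ v → onlyAt x v c ≡ c
  onlyAt-≡ {x = x} {v} c x≡v with x ≟ v
  ... | yes _   = ≡.refl
  ... | no x≢v = ⊥-elim (x≢v x≡v)

  onlyAt-≢ : ∀ {k} {x v : Fin k} c → ¬ x ≡ v → onlyAt x v c ≡ ε
  onlyAt-≢ {x = x} {v} c x≢v with x ≟ v
  ... | yes x≡v = ⊥-elim (x≢v x≡v)
  ... | no  _   = ≡.refl

  onlyAt-cong : ∀ {k} (x v : Fin k) {c d} → c ≈ d → onlyAt x v c ≈ onlyAt x v d
  onlyAt-cong x v c≈d with x ≟ v
  ... | yes _ = c≈d
  ... | no  _ = refl

  onlyAt-∙ : ∀ {k} (x v : Fin k) c d → onlyAt x v (c ∙ d) ≈ onlyAt x v c ∙ onlyAt x v d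
  onlyAt-∙ x v c d with x ≟ v
  ... | yes _ = refl
  ... | no  _ = sym (identityˡ ε)

  onlyAt-⊛-∙ : ∀ {k} (x v : Fin k) s a b → onlyAt x v (s ⊛ (a ∙ b)) ≈ onlyAt x v (s ⊛ a) ∙ onlyAt x v (s ⊛ b)
  onlyAt-⊛-∙ x v s a b = trans (onlyAt-cong x v (sym (⊛-∙ s a b))) (onlyAt-∙ x v _ _)

  onlyAt-ε : ∀ {k} (x v : Fin k) → onlyAt x v ε ≈ ε
  onlyAt-ε x v with x ≟ v
  ... | yes _ = refl
  ... | no  _ = refl

  module _ {k k′} {φ : Fin k → Fin k′} {y : Fin k′} where

    onlyAt-fiber₁ : ∀ {z} → (∀ x → φ x ≡ y → x ≡ z) → φ z ≡ y → ∀ x c → onlyAt (φ x) y c ≈ onlyAt x z c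
    onlyAt-fiber₁ {z} fiber φz≡y x c = reflexive (cases (x ≟ z))
      where
      cases : Dec (x ≡ z) → onlyAt (φ x) y c ≡ onlyAt x z c
      cases (yes x≡z) = ≡.trans (onlyAt-≡ c (≡.trans (≡.cong φ x≡z) φz≡y)) (≡.sym (onlyAt-≡ c x≡z))
      cases (no  x≢z) = ≡.trans (onlyAt-≢ c (x≢z ∘ fiber x)) (≡.sym (onlyAt-≢ c x≢z))

    onlyAt-fiber₂ : ∀ {z₁ z₂} → ¬ z₁ ≡ z₂ → (∀ x → φ x ≡ y → x ≡ z₁ ⊎ x ≡ z₂) → φ z₁ ≡ y → φ z₂ ≡ y →
                    ∀ x c → onlyAt (φ x) y c ≈ onlyAt x z₁ c ∙ onlyAt x z₂ c
    onlyAt-fiber₂ {z₁} {z₂} z₁≢z₂ fiber φz₁≡y φz₂≡y x c = cases (x ≟ z₁) (x ≟ z₂)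
      where
      cases : Dec (x ≡ z₁) → Dec (x ≡ z₂) → onlyAt (φ x) y c ≈ onlyAt x z₁ c ∙ onlyAt x z₂ c
      cases (yes x≡z₁) (yes x≡z₂) = ⊥-elim (z₁≢z₂ (≡.trans (≡.sym x≡z₁) x≡z₂))
      cases (yes x≡z₁) (no  x≢z₂) = begin
        onlyAt (φ x) y c              ≡⟨ onlyAt-≡ c (≡.trans (≡.cong φ x≡z₁) φz₁≡y) ⟩
        c                             ≈⟨ identityʳ c ⟨
        c ∙ ε                         ≡⟨ ≡.cong₂ _∙_ (onlyAt-≡ c x≡z₁) (onlyAt-≢ c x≢z₂) ⟨
        onlyAt x z₁ c ∙ onlyAt x z₂ c ∎
      cases (no  x≢z₁) (yes x≡z₂) = begin
        onlyAt (φ x) y c              ≡⟨ onlyAt-≡ c (≡.trans (≡.cong φ x≡z₂) φz₂≡y) ⟩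
        c                             ≈⟨ identityˡ c ⟨
        ε ∙ c                         ≡⟨ ≡.cong₂ _∙_ (onlyAt-≢ c x≢z₁) (onlyAt-≡ c x≡z₂) ⟨
        onlyAt x z₁ c ∙ onlyAt x z₂ c ∎
      cases (no  x≢z₁) (no  x≢z₂) = begin
        onlyAt (φ x) y c              ≡⟨ onlyAt-≢ c ([ x≢z₁ , x≢z₂ ]′ ∘ fiber x) ⟩
        ε                             ≈⟨ identityˡ ε ⟨
        ε ∙ ε                         ≡⟨ ≡.cong₂ _∙_ (onlyAt-≢ c x≢z₁) (onlyAt-≢ c x≢z₂) ⟨
        onlyAt x z₁ c ∙ onlyAt x z₂ c ∎

module GraphOperations where

  open import Data.Nat using (suc)
  open import Data.Fin using (Fin; punchIn)
  open import Data.Bool using (false; true)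
  open import Data.Sign using (Sign) renaming (_*_ to _·_)

  module _ {n m : ℕ} (Γ : SignedGraph n (suc m)) (e₀ : Fin (suc m)) where
    open SignedGraph Γ

    _∖_ : SignedGraph n m
    _∖_ = record { end = λ e → end (punchIn e₀ e) ; sign = λ e → sign (punchIn e₀ e) }

    restrictOrientation : Orientation Γ → Orientation _∖_
    restrictOrientation ω e = ω (punchIn e₀ e)

    restrict-compatible : ∀ ω → Compatible Γ ω → Compatible _∖_ (restrictOrientation ω)
    restrict-compatible ω compat e = compat (punchIn e₀ e)

  AllLoops : ∀ {n m} → SignedGraph n m → Set
  AllLoops Γ = ∀ e → SignedGraph.end Γ e false ≡ SignedGraph.end Γ e true

  relabel : ∀ {n n′ m} → (Fin n → Fin n′) → SignedGraph n m → SignedGraph n′ m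
  relabel φ Γ = record { end = λ e β → φ (end e β) ; sign = sign }
    where open SignedGraph Γ

  module _ {n m : ℕ} (Γ : SignedGraph n m) (τ : Fin n → Sign) where
    open SignedGraph Γ

    switch : SignedGraph n m
    switch = record { end = end ; sign = λ e → sign e · (τ (end e false) · τ (end e true)) }

    switchOrientation : Orientation Γ → Orientation switch
    switchOrientation ω e β = τ (end e β) · ω e β

module Boundary {c ℓ} (G : AbelianGroup c ℓ) where

  open import Data.Nat using (suc)
  open import Data.Fin using (Fin; punchIn)
  open import Data.Fin.Properties using (_≟_)
  open import Data.Vec.Functional using (removeAt)
  open import Data.Bool using (false; true)
  open import Data.Sum using (_⊎_)
  open import Relation.Nullary using (¬_; yes; no)
  open import Relation.Binary.PropositionalEquality as ≡ using ()
  open AbelianGroup G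
  open import Algebra.Properties.CommutativeSemigroup commutativeSemigroup using (interchange)
  open import Relation.Binary.Reasoning.Setoid setoid
  open GroupSums G
  open GraphOperations

  module _ {n m : ℕ} (Γ : SignedGraph n m) (ω : Orientation Γ) where
    open SignedGraph Γ

    edgeTerm : (Fin m → Carrier) → Fin n → Fin m → Carrier
    edgeTerm f v e = onlyAt (end e false) v (ω e false ⊛ f e) ∙ onlyAt (end e true) v (ω e true ⊛ f e)

    ∂ : (Fin m → Carrier) → Fin n → Carrier
    ∂ f v = ∑ (λ e → halfTerm G Γ ω f v e false ∙ halfTerm G Γ ω f v e true)

    halfTerm-onlyAt : ∀ f v e β → halfTerm G Γ ω f v e β ≡ onlyAt (end e β) v (ω e β ⊛ f e)
    halfTerm-onlyAt f v e β with end e β ≟ v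
    ... | yes _ = ≡.refl
    ... | no  _ = ≡.refl

    ∂≈∑edgeTerm : ∀ f v → ∂ f v ≈ ∑ (edgeTerm f v)
    ∂≈∑edgeTerm f v =
      ∑-cong (λ e → reflexive (≡.cong₂ _∙_ (halfTerm-onlyAt f v e false) (halfTerm-onlyAt f v e true)))

    edgeTerm-cong : ∀ {f g} → (∀ e → f e ≈ g e) → ∀ v e → edgeTerm f v e ≈ edgeTerm g v e
    edgeTerm-cong f≈g v e = ∙-cong (onlyAt-cong (end e false) v (⊛-cong (ω e false) (f≈g e)))
                                   (onlyAt-cong (end e true) v (⊛-cong (ω e true) (f≈g e)))

    ∂-cong : ∀ {f g} → (∀ e → f e ≈ g e) → ∀ v → ∂ f v ≈ ∂ g v
    ∂-cong {f} {g} f≈g v = begin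
      ∂ f v              ≈⟨ ∂≈∑edgeTerm f v ⟩
      ∑ (edgeTerm f v)   ≈⟨ ∑-cong (edgeTerm-cong f≈g v) ⟩
      ∑ (edgeTerm g v)   ≈⟨ ∂≈∑edgeTerm g v ⟨
      ∂ g v              ∎

    edgeTerm-ε : ∀ f v e → f e ≈ ε → edgeTerm f v e ≈ ε
    edgeTerm-ε f v e fe≈ε =
      trans (∙-cong (term-ε (end e false) (ω e false)) (term-ε (end e true) (ω e true))) (identityˡ ε)
      where
      term-ε : ∀ x s → onlyAt x v (s ⊛ f e) ≈ ε
      term-ε x s = trans (onlyAt-cong x v (trans (⊛-cong s fe≈ε) (⊛-ε s))) (onlyAt-ε x v)

    edgeTerm-∙ : ∀ f g v e → edgeTerm (λ i → f i ∙ g i) v e ≈ edgeTerm f v e ∙ edgeTerm g v e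
    edgeTerm-∙ f g v e = trans (∙-cong (onlyAt-⊛-∙ (end e false) v (ω e false) (f e) (g e))
                                       (onlyAt-⊛-∙ (end e true) v (ω e true) (f e) (g e)))
                               (interchange _ _ _ _)

    ∂-∙ : ∀ f g v → ∂ (λ i → f i ∙ g i) v ≈ ∂ f v ∙ ∂ g v
    ∂-∙ f g v = begin
      ∂ (λ i → f i ∙ g i) v                   ≈⟨ ∂≈∑edgeTerm _ v ⟩
      ∑ (edgeTerm (λ i → f i ∙ g i) v)        ≈⟨ ∑-cong (edgeTerm-∙ f g v) ⟩
      ∑ (λ e → edgeTerm f v e ∙ edgeTerm g v e) ≈⟨ ∑-∙ (edgeTerm f v) (edgeTerm g v) ⟩
      ∑ (edgeTerm f v) ∙ ∑ (edgeTerm g v)     ≈⟨ ∙-cong (∂≈∑edgeTerm f v) (∂≈∑edgeTerm g v) ⟨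
      ∂ f v ∙ ∂ g v                           ∎

  module _ {n m : ℕ} (Γ : SignedGraph n (suc m)) (ω : Orientation Γ) (e₀ : Fin (suc m)) where

    ∂-delete : ∀ f v →
               ∂ Γ ω f v ≈ edgeTerm Γ ω f v e₀ ∙ ∂ (Γ ∖ e₀) (restrictOrientation Γ e₀ ω) (removeAt f e₀) v
    ∂-delete f v = begin
      ∂ Γ ω f v                                                       ≈⟨ ∂≈∑edgeTerm Γ ω f v ⟩
      ∑ (edgeTerm Γ ω f v)                                            ≈⟨ ∑-punchIn e₀ (edgeTerm Γ ω f v) ⟩
      edgeTerm Γ ω f v e₀ ∙ ∑ (λ e → edgeTerm Γ ω f v (punchIn e₀ e))
        ≈⟨ ∙-congˡ (∂≈∑edgeTerm (Γ ∖ e₀) _ (removeAt f e₀) v) ⟨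
      edgeTerm Γ ω f v e₀ ∙ ∂ (Γ ∖ e₀) _ (removeAt f e₀) v             ∎

  module _ {n n′ m : ℕ} (Δ : SignedGraph n m) (ω : Orientation Δ) (φ : Fin n → Fin n′) {y : Fin n′} where
    open SignedGraph Δ

    ∂-relabel-fiber₁ : ∀ {z} → (∀ x → φ x ≡ y → x ≡ z) → φ z ≡ y → ∀ f → ∂ (relabel φ Δ) ω f y ≈ ∂ Δ ω f z
    ∂-relabel-fiber₁ {z} fiber φz≡y f = begin
      ∂ (relabel φ Δ) ω f y            ≈⟨ ∂≈∑edgeTerm (relabel φ Δ) ω f y ⟩
      ∑ (edgeTerm (relabel φ Δ) ω f y) ≈⟨ ∑-cong (λ e → ∙-cong (onlyAt-fiber₁ fiber φz≡y (end e false) _)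
                                                              (onlyAt-fiber₁ fiber φz≡y (end e true) _)) ⟩
      ∑ (edgeTerm Δ ω f z)             ≈⟨ ∂≈∑edgeTerm Δ ω f z ⟨
      ∂ Δ ω f z                        ∎

    ∂-relabel-fiber₂ : ∀ {z₁ z₂} → ¬ z₁ ≡ z₂ → (∀ x → φ x ≡ y → x ≡ z₁ ⊎ x ≡ z₂) → φ z₁ ≡ y → φ z₂ ≡ y →
                       ∀ f → ∂ (relabel φ Δ) ω f y ≈ ∂ Δ ω f z₁ ∙ ∂ Δ ω f z₂
    ∂-relabel-fiber₂ {z₁} {z₂} z₁≢z₂ fiber φz₁≡y φz₂≡y f = begin
      ∂ (relabel φ Δ) ω f y                                ≈⟨ ∂≈∑edgeTerm (relabel φ Δ) ω f y ⟩
      ∑ (edgeTerm (relabel φ Δ) ω f y)                     ≈⟨ ∑-cong split ⟩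
      ∑ (λ e → edgeTerm Δ ω f z₁ e ∙ edgeTerm Δ ω f z₂ e)  ≈⟨ ∑-∙ (edgeTerm Δ ω f z₁) _ ⟩
      ∑ (edgeTerm Δ ω f z₁) ∙ ∑ (edgeTerm Δ ω f z₂)        ≈⟨ ∙-cong (∂≈∑edgeTerm Δ ω f z₁) (∂≈∑edgeTerm Δ ω f z₂) ⟨
      ∂ Δ ω f z₁ ∙ ∂ Δ ω f z₂                              ∎
      where
      split : ∀ e → edgeTerm (relabel φ Δ) ω f y e ≈ edgeTerm Δ ω f z₁ e ∙ edgeTerm Δ ω f z₂ e
      split e = trans (∙-cong (onlyAt-fiber₂ z₁≢z₂ fiber φz₁≡y φz₂≡y (end e false) _)
                              (onlyAt-fiber₂ z₁≢z₂ fiber φz₁≡y φz₂≡y (end e true) _))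
                      (interchange _ _ _ _)

module SignAlgebra where

  open import Data.Sign using (Sign; opposite) renaming (_*_ to _·_)
  open import Data.Sign.Properties using (*-commutativeSemigroup; opposite-involutive) renaming (*-comm to ·-comm)
  open import Algebra.Properties.CommutativeSemigroup *-commutativeSemigroup public
    using () renaming (interchange to ·-interchange)
  open import Relation.Binary.PropositionalEquality using (refl; sym; cong₂; trans)

  opposite-·ˡ : ∀ s t → opposite s · t ≡ opposite (s · t)
  opposite-·ˡ Sign.+ t = refl
  opposite-·ˡ Sign.- t = sym (opposite-involutive t)

  ·-interchange′ : ∀ a b c d → (a · b) · (c · d) ≡ (c · a) · (d · b)
  ·-interchange′ a b c d = trans (·-interchange a b c d) (cong₂ _·_ (·-comm a c) (·-comm b d))

  opposite[s·t]≡+ : ∀ s t → opposite (s · t) ≡ Sign.+ → s ≡ opposite t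
  opposite[s·t]≡+ Sign.+ Sign.- _ = refl
  opposite[s·t]≡+ Sign.- Sign.+ _ = refl

  opposite[s·t]≡- : ∀ s t → opposite (s · t) ≡ Sign.- → s ≡ t
  opposite[s·t]≡- Sign.+ Sign.+ _ = refl
  opposite[s·t]≡- Sign.- Sign.- _ = refl

module CyclicOrder where

  open import Data.Nat using (zero; suc)
  open import Data.Fin using (Fin; zero; suc; inject₁; fromℕ; toℕ)
  open import Data.Fin.Properties using (suc-injective; toℕ-inject₁)
  open import Data.Fin.Relation.Unary.Top using (view; ‵fromℕ; ‵inject₁; view-fromℕ; view-inject₁)
  import Data.Nat.Properties as ℕ
  open import Relation.Binary.PropositionalEquality as ≡ using (refl; trans; cong)
  open import Function.Definitions using (Injective)

  cyclicSuc : ∀ {k} → Fin (suc k) → Fin (suc k)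
  cyclicSuc i with view i
  ... | ‵fromℕ     = zero
  ... | ‵inject₁ j = suc j

  cyclicSuc-inject₁ : ∀ {k} (i : Fin k) → cyclicSuc (inject₁ i) ≡ suc i
  cyclicSuc-inject₁ i rewrite view-inject₁ i = refl

  cyclicSuc-fromℕ : ∀ k → cyclicSuc (fromℕ k) ≡ zero
  cyclicSuc-fromℕ k rewrite view-fromℕ k = refl

  cyclicSuc-injective : ∀ {k} → Injective _≡_ _≡_ (cyclicSuc {k})
  cyclicSuc-injective {k} {i} {j} with view i | view j
  ... | ‵fromℕ     | ‵fromℕ     = λ _ → refl
  ... | ‵fromℕ     | ‵inject₁ _ = λ ()
  ... | ‵inject₁ _ | ‵fromℕ     = λ ()
  ... | ‵inject₁ _ | ‵inject₁ _ = λ eq → cong inject₁ (suc-injective eq)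

  cyclicSuc^ : ∀ {k} → ℕ → Fin (suc k) → Fin (suc k)
  cyclicSuc^ zero    i = i
  cyclicSuc^ (suc r) i = cyclicSuc (cyclicSuc^ r i)

  cyclicSuc^-comm : ∀ {k} r (i : Fin (suc k)) → cyclicSuc^ r (cyclicSuc i) ≡ cyclicSuc (cyclicSuc^ r i)
  cyclicSuc^-comm zero    i = refl
  cyclicSuc^-comm (suc r) i = cong cyclicSuc (cyclicSuc^-comm r i)

  cyclicSuc^-injective : ∀ {k} r → Injective _≡_ _≡_ (cyclicSuc^ {k} r)
  cyclicSuc^-injective zero    eq = eq
  cyclicSuc^-injective (suc r) eq = cyclicSuc^-injective r (cyclicSuc-injective eq)

  cyclicSuc^-toℕ : ∀ {k} (j : Fin (suc k)) → cyclicSuc^ (toℕ j) zero ≡ j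
  cyclicSuc^-toℕ j = reach (toℕ j) j refl
    where
    reach : ∀ {k} r (j : Fin (suc k)) → toℕ j ≡ r → cyclicSuc^ r zero ≡ j
    reach zero    zero    _  = refl
    reach {suc k} (suc r) (suc j) eq =
      trans (cong cyclicSuc (reach r (inject₁ j) (trans (toℕ-inject₁ j) (ℕ.suc-injective eq)))) (cyclicSuc-inject₁ j)

module Cycles {n m : ℕ} (Γ : SignedGraph n m) where

  open import Data.Nat using (zero; suc)
  open import Data.Fin using (Fin; zero; suc; inject₁; fromℕ; toℕ)
  open import Data.Bool using (false; true)
  open import Data.Sign using (Sign) renaming (_*_ to _·_)
  open import Data.Sign.Properties using (s*s≡+) renaming (*-comm to ·-comm; *-assoc to ·-assoc)
  open import Data.Product using (∃; _,_)
  open import Data.Sum using (_⊎_; inj₁; inj₂)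
  open import Relation.Nullary using (¬_)
  open import Relation.Binary.PropositionalEquality as ≡ using (refl; sym; trans; cong; cong₂; subst; module ≡-Reasoning)
  open import Relation.Binary.Construct.Closure.ReflexiveTransitive using (_◅◅_; _◅_; reverse) renaming (ε to ε*)
  open import Data.Fin.Relation.Unary.Top using (view; ‵fromℕ; ‵inject₁)
  open import Function.Base using (_∘_)
  open import Function.Definitions using (Injective)
  open SignedGraph Γ
  open CyclicOrder
  open SignAlgebra

  -- prodSign ignores its graph argument, so the products Π of different graphs agree definitionally.
  Π : ∀ {k} → (Fin k → Sign) → Sign
  Π = prodSign Γ

  Π-cong : ∀ {k} {f g : Fin k → Sign} → (∀ i → f i ≡ g i) → Π f ≡ Π g
  Π-cong {zero}  f≡g = refl
  Π-cong {suc k} f≡g = cong₂ _·_ (f≡g zero) (Π-cong (λ i → f≡g (suc i)))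

  Π-· : ∀ {k} (f g : Fin k → Sign) → Π (λ i → f i · g i) ≡ Π f · Π g
  Π-· {zero}  f g = refl
  Π-· {suc k} f g rewrite Π-· (λ i → f (suc i)) (λ i → g (suc i)) = ·-interchange (f zero) (g zero) _ _

  Π-last : ∀ {k} (f : Fin (suc k) → Sign) → Π f ≡ Π (λ i → f (inject₁ i)) · f (fromℕ k)
  Π-last {zero}  f = ·-comm (f zero) Sign.+
  Π-last {suc k} f rewrite Π-last (λ i → f (suc i)) = sym (·-assoc (f zero) _ _)

  Π-cyclicSuc : ∀ {k} (f : Fin (suc k) → Sign) → Π (λ i → f (cyclicSuc i)) ≡ Π f
  Π-cyclicSuc {k} f = begin
    Π (λ i → f (cyclicSuc i))                                      ≡⟨ Π-last (λ i → f (cyclicSuc i)) ⟩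
    Π (λ i → f (cyclicSuc (inject₁ i))) · f (cyclicSuc (fromℕ k))
      ≡⟨ cong₂ _·_ (Π-cong (λ i → cong f (cyclicSuc-inject₁ i))) (cong f (cyclicSuc-fromℕ k)) ⟩
    Π (λ i → f (suc i)) · f zero                                   ≡⟨ ·-comm _ (f zero) ⟩
    Π f                                                            ∎
    where open ≡-Reasoning

  Π-cyclicSuc^ : ∀ {k} r (f : Fin (suc k) → Sign) → Π (λ i → f (cyclicSuc^ r i)) ≡ Π f
  Π-cyclicSuc^ zero    f = refl
  Π-cyclicSuc^ (suc r) f = trans (Π-cong (λ i → cong f (sym (cyclicSuc^-comm r i))))
                           (trans (Π-cyclicSuc (λ i → f (cyclicSuc^ r i))) (Π-cyclicSuc^ r f))

  Π-telescope : ∀ {k} (s : Fin (suc k) → Sign) → Π (λ i → s i · s (cyclicSuc i)) ≡ Sign.+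
  Π-telescope s = begin
    Π (λ i → s i · s (cyclicSuc i))      ≡⟨ Π-· s (λ i → s (cyclicSuc i)) ⟩
    Π s · Π (λ i → s (cyclicSuc i))      ≡⟨ cong (Π s ·_) (Π-cyclicSuc s) ⟩
    Π s · Π s                            ≡⟨ s*s≡+ (Π s) ⟩
    Sign.+                               ∎
    where open ≡-Reasoning

  joins-adj : ∀ {e a b} → Joins Γ e a b → Adj Γ a b
  joins-adj j = _ , j

  joins-· : ∀ (s : Fin n → Sign) {e a b} → Joins Γ e a b → s (end e false) · s (end e true) ≡ s a · s b
  joins-· s (inj₁ (refl , refl)) = refl
  joins-· s {e} (inj₂ (refl , refl)) = ·-comm (s (end e false)) (s (end e true))

  module _ {k : ℕ} where

    cycleStep : (C : Cycle Γ k) → ∀ i → Joins Γ (Cycle.es C i) (Cycle.vs C i) (Cycle.vs C (cyclicSuc i))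
    cycleStep C i with view i
    ... | ‵fromℕ     = Cycle.close C
    ... | ‵inject₁ j = Cycle.step C j

    cycle : (vs : Fin (suc k) → Fin n) (es : Fin (suc k) → Fin m) →
            Injective _≡_ _≡_ vs → Injective _≡_ _≡_ es →
            (∀ i → Joins Γ (es i) (vs i) (vs (cyclicSuc i))) → Cycle Γ k
    cycle vs es vs-inj es-inj steps = record
      { vs = vs ; es = es ; vs-inj = vs-inj ; es-inj = es-inj
      ; step  = λ j → subst (Joins Γ (es (inject₁ j)) (vs (inject₁ j)) ∘ vs) (cyclicSuc-inject₁ j)
                            (steps (inject₁ j))
      ; close = subst (Joins Γ (es (fromℕ k)) (vs (fromℕ k)) ∘ vs) (cyclicSuc-fromℕ k) (steps (fromℕ k)) }

    rotate : ℕ → Cycle Γ k → Cycle Γ k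
    rotate r C = cycle (vs ∘ cyclicSuc^ r) (es ∘ cyclicSuc^ r)
                   (cyclicSuc^-injective r ∘ vs-inj) (cyclicSuc^-injective r ∘ es-inj)
                   (λ i → subst (Joins Γ (es (cyclicSuc^ r i)) (vs (cyclicSuc^ r i)) ∘ vs) (sym (cyclicSuc^-comm r i))
                                (cycleStep C (cyclicSuc^ r i)))
      where open Cycle C

    rotate-sign : ∀ r (C : Cycle Γ k) → Π (sign ∘ Cycle.es (rotate r C)) ≡ Π (sign ∘ Cycle.es C)
    rotate-sign r C = Π-cyclicSuc^ r (sign ∘ Cycle.es C)

    connected-along : (C : Cycle Γ k) → ∀ j → Connected Γ (Cycle.vs C zero) (Cycle.vs C j)
    connected-along C j = subst (Connected Γ (vs zero) ∘ vs) (cyclicSuc^-toℕ j) (walk (toℕ j))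
      where
      open Cycle C
      walk : ∀ r → Connected Γ (vs zero) (vs (cyclicSuc^ r zero))
      walk zero    = ε*
      walk (suc r) = walk r ◅◅ (joins-adj (cycleStep C (cyclicSuc^ r zero)) ◅ ε*)

    Π-switching : (s : Fin n → Sign) (C : Cycle Γ k) →
                  Π (λ i → s (end (Cycle.es C i) false) · s (end (Cycle.es C i) true)) ≡ Sign.+
    Π-switching s C = trans (Π-cong (λ i → joins-· s (cycleStep C i))) (Π-telescope (s ∘ Cycle.vs C))

  SwitchingBalanced : Fin n → Set
  SwitchingBalanced x = ∃ λ (s : Fin n → Sign) →
    ∀ e → Connected Γ x (end e false) → sign e ≡ s (end e false) · s (end e true)

  -- Proved along with the flow count: it is what lets a contraction transfer the balance of a
  -- component in both directions.
  BalanceDichotomy : Set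
  BalanceDichotomy = ∀ x → SwitchingBalanced x ⊎ UnbalancedComp Γ x

  connected-joins : ∀ {x e a b} → Joins Γ e a b → Connected Γ x a → Connected Γ x (end e false)
  connected-joins (inj₁ (refl , _)) c = c
  connected-joins (inj₂ (refl , q)) c = c ◅◅ ((_ , inj₂ (refl , q)) ◅ ε*)

  switchingBalanced⇒balanced : ∀ {x} → SwitchingBalanced x → BalancedComp Γ x
  switchingBalanced⇒balanced {x} (s , sign≡) k C x~C = begin
    Π (sign ∘ es)                                         ≡⟨ Π-cong (λ i → sign≡ (es i) (edge-reached i)) ⟩
    Π (λ i → s (end (es i) false) · s (end (es i) true))   ≡⟨ Π-switching s C ⟩
    Sign.+                                                ∎
    where
    open Cycle C
    open ≡-Reasoning
    edge-reached : ∀ i → Connected Γ x (end (es i) false)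
    edge-reached i = connected-joins (cycleStep C i) (x~C ◅◅ connected-along C i)

  unbalanced⇒¬balanced : ∀ {x} → UnbalancedComp Γ x → ¬ BalancedComp Γ x
  unbalanced⇒¬balanced (k , C , x~C , ¬bal) bal = ¬bal (bal k C x~C)

  switchingBalanced-resp : ∀ {x z} → Connected Γ x z → SwitchingBalanced z → SwitchingBalanced x
  switchingBalanced-resp x~z (s , sign≡) = s , λ e x~e → sign≡ e (reverse (Adj-sym Γ) x~z ◅◅ x~e)

  unbalanced-resp : ∀ {x z} → Connected Γ x z → UnbalancedComp Γ z → UnbalancedComp Γ x
  unbalanced-resp x~z (k , C , z~C , ¬bal) = k , C , x~z ◅◅ z~C , ¬bal

module Components where

  open import Level using (0ℓ)
  open import Relation.Binary using (Setoid)
  open import Data.Fin using (Fin)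
  open import Data.Product using (_,_; proj₁)
  open import Relation.Binary.Construct.Closure.ReflexiveTransitive using (_◅◅_)
  import Relation.Binary.Construct.On as On
  open import Function.Bundles using (Inverse)

  ComponentsWith : ∀ {n m} → SignedGraph n m → (Fin n → Set) → Setoid 0ℓ 0ℓ
  ComponentsWith Γ P = On.setoid (ConnectedSetoid Γ) (proj₁ {B = P})

  module _ {n₁ m₁ n₂ m₂ : ℕ} {Γ₁ : SignedGraph n₁ m₁} {Γ₂ : SignedGraph n₂ m₂}
    (φ : Fin n₁ → Fin n₂) (ψ : Fin n₂ → Fin n₁)
    (φ-conn : ∀ {x y} → Connected Γ₁ x y → Connected Γ₂ (φ x) (φ y))
    (ψ-conn : ∀ {x y} → Connected Γ₂ x y → Connected Γ₁ (ψ x) (ψ y))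
    (φψ : ∀ y → Connected Γ₂ (φ (ψ y)) y) (ψφ : ∀ x → Connected Γ₁ (ψ (φ x)) x) where

    components-inverse : {P : Fin n₁ → Set} {Q : Fin n₂ → Set} →
                         (∀ {x} → P x → Q (φ x)) → (∀ {y} → Q y → P (ψ y)) →
                         Inverse (ComponentsWith Γ₁ P) (ComponentsWith Γ₂ Q)
    components-inverse P⇒Q Q⇒P = record
      { to = λ { (x , p) → φ x , P⇒Q p }
      ; from = λ { (y , q) → ψ y , Q⇒P q }
      ; to-cong = φ-conn
      ; from-cong = ψ-conn
      ; inverse = (λ {y} c → φ-conn c ◅◅ φψ (proj₁ y)) , (λ {x} c → ψ-conn c ◅◅ ψφ (proj₁ x)) }

module Switching {n m : ℕ} (Γ : SignedGraph n m) (τ : Fin n → Sign) where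

  open import Data.Fin using (Fin)
  open import Data.Fin.Properties using (_≟_)
  open import Data.Bool using (false; true)
  open import Data.Sign using (Sign; opposite) renaming (_*_ to _·_)
  open import Data.Sign.Properties using (s*s≡+) renaming (*-assoc to ·-assoc; *-identityʳ to ·-identityʳ)
  open import Data.Product using (_,_)
  open import Data.Sum using (inj₁; inj₂)
  open import Relation.Nullary using (yes; no)
  open import Relation.Binary.PropositionalEquality as ≡ using (refl; sym; trans; cong; module ≡-Reasoning)
  open import Relation.Binary.Construct.Closure.ReflexiveTransitive using () renaming (ε to ε*)
  open import Function.Base using (_∘_; id)
  open import Function.Bundles using (Inverse)
  open SignedGraph Γ
  open SignAlgebra
  open GraphOperations
  open Components

  private
    Γ′ = switch Γ τ
    module C = Cycles Γ
    module C′ = Cycles Γ′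

  switch-compatible : ∀ ω → Compatible Γ ω → Compatible Γ′ (switchOrientation Γ τ ω)
  switch-compatible ω compat e = begin
    sign e · (τ a · τ b)                            ≡⟨ cong (_· (τ a · τ b)) (compat e) ⟩
    opposite (ω e false · ω e true) · (τ a · τ b)   ≡⟨ opposite-·ˡ (ω e false · ω e true) (τ a · τ b) ⟩
    opposite ((ω e false · ω e true) · (τ a · τ b)) ≡⟨ cong opposite (·-interchange′ _ _ (τ a) (τ b)) ⟩
    opposite ((τ a · ω e false) · (τ b · ω e true)) ∎
    where
    open ≡-Reasoning
    a b : Fin n
    a = end e false
    b = end e true

  to-cycle : ∀ {k} → Cycle Γ′ k → Cycle Γ k
  to-cycle C = record { vs = vs ; es = es ; vs-inj = vs-inj ; es-inj = es-inj ; step = step ; close = close }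
    where open Cycle C

  from-cycle : ∀ {k} → Cycle Γ k → Cycle Γ′ k
  from-cycle C = record { vs = vs ; es = es ; vs-inj = vs-inj ; es-inj = es-inj ; step = step ; close = close }
    where open Cycle C

  cycle-sign : ∀ {k} (C : Cycle Γ k) →
               C′.Π (SignedGraph.sign Γ′ ∘ Cycle.es C) ≡ C.Π (sign ∘ Cycle.es C)
  cycle-sign {k} C = begin
    C.Π (λ i → sign (es i) · t i)     ≡⟨ C.Π-· (sign ∘ es) t ⟩
    C.Π (sign ∘ es) · C.Π t           ≡⟨ cong (C.Π (sign ∘ es) ·_) (C.Π-switching τ C) ⟩
    C.Π (sign ∘ es) · Sign.+          ≡⟨ ·-identityʳ _ ⟩
    C.Π (sign ∘ es)                   ∎
    where
    open Cycle C
    open ≡-Reasoning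
    t : Fin (suc k) → Sign
    t i = τ (end (es i) false) · τ (end (es i) true)

  balanced-to : ∀ {x} → BalancedComp Γ′ x → BalancedComp Γ x
  balanced-to bal k C x~C = trans (sym (cycle-sign C)) (bal k (from-cycle C) x~C)

  balanced-from : ∀ {x} → BalancedComp Γ x → BalancedComp Γ′ x
  balanced-from bal k C x~C = trans (cycle-sign (to-cycle C)) (bal k (to-cycle C) x~C)

  unbalanced-to : ∀ {x} → UnbalancedComp Γ′ x → UnbalancedComp Γ x
  unbalanced-to (k , C , x~C , ¬bal) = k , to-cycle C , x~C , ¬bal ∘ trans (cycle-sign (to-cycle C))

  unbalanced-from : ∀ {x} → UnbalancedComp Γ x → UnbalancedComp Γ′ x
  unbalanced-from (k , C , x~C , ¬bal) = k , from-cycle C , x~C , ¬bal ∘ trans (sym (cycle-sign C))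

  switchingBalanced-to : ∀ {x} → C′.SwitchingBalanced x → C.SwitchingBalanced x
  switchingBalanced-to (s , sign≡) = (λ v → s v · τ v) , λ e x~e → unswitch e (sign≡ e x~e)
    where
    unswitch : ∀ e → SignedGraph.sign Γ′ e ≡ s (end e false) · s (end e true) →
               sign e ≡ (s (end e false) · τ (end e false)) · (s (end e true) · τ (end e true))
    unswitch e sign′≡ = begin
      sign e                    ≡⟨ ·-identityʳ (sign e) ⟨
      sign e · Sign.+           ≡⟨ cong (sign e ·_) (s*s≡+ t) ⟨
      sign e · (t · t)          ≡⟨ ·-assoc (sign e) t t ⟨
      (sign e · t) · t          ≡⟨ cong (_· t) sign′≡ ⟩
      (s a · s b) · (τ a · τ b) ≡⟨ ·-interchange (s a) (s b) (τ a) (τ b) ⟩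
      (s a · τ a) · (s b · τ b) ∎
      where
      open ≡-Reasoning
      a b : Fin n
      a = end e false
      b = end e true
      t : Sign
      t = τ a · τ b

  dichotomy-to : C′.BalanceDichotomy → C.BalanceDichotomy
  dichotomy-to dich x with dich x
  ... | inj₁ sb = inj₁ (switchingBalanced-to sb)
  ... | inj₂ ub = inj₂ (unbalanced-to ub)

  balancedComps-inverse : Inverse (BalancedComps Γ) (BalancedComps Γ′)
  balancedComps-inverse = components-inverse id id id id (λ _ → ε*) (λ _ → ε*) balanced-from balanced-to

  unbalancedComps-inverse : Inverse (UnbalancedComps Γ) (UnbalancedComps Γ′)
  unbalancedComps-inverse = components-inverse id id id id (λ _ → ε*) (λ _ → ε*) unbalanced-from unbalanced-to

  module _ {c ℓ} (G : AbelianGroup c ℓ) (ω : Orientation Γ) where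
    open AbelianGroup G using (_≈_; _∙_; ∙-cong) renaming (sym to ≈-sym; trans to ≈-trans)
    open GroupSums G
    open Boundary G

    private
      ω′ : Orientation Γ′
      ω′ = switchOrientation Γ τ ω

    halfTerm-switch : ∀ f v e β → halfTerm G Γ′ ω′ f v e β ≈ τ v ⊛ halfTerm G Γ ω f v e β
    halfTerm-switch f v e β with end e β ≟ v
    ... | yes refl = ⊛-· (τ (end e β)) (ω e β) (f e)
    ... | no  _    = ≈-sym (⊛-ε (τ v))

    ∂-switch : ∀ f v → ∂ Γ′ ω′ f v ≈ τ v ⊛ ∂ Γ ω f v
    ∂-switch f v = ≈-trans (∑-cong (λ e → ≈-trans (∙-cong (halfTerm-switch f v e false) (halfTerm-switch f v e true))
                                                  (⊛-∙ (τ v) _ _)))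
                           (∑-⊛ (τ v) (λ e → halfTerm G Γ ω f v e false ∙ halfTerm G Γ ω f v e true))

    switch-flows-inverse : Inverse (FlowSetoid G Γ ω) (FlowSetoid G Γ′ ω′)
    switch-flows-inverse = record
      { to = λ { (f , flow) → f , λ v → ≈-trans (∂-switch f v) (≈-trans (⊛-cong (τ v) (flow v)) (⊛-ε (τ v))) }
      ; from = λ { (f , flow) → f , λ v → ⊛≈ε⇒≈ε (τ v) (≈-trans (≈-sym (∂-switch f v)) (flow v)) }
      ; to-cong = id ; from-cong = id ; inverse = id , id }

module MergeVertices {n : ℕ} {a b : Fin (suc n)} (a≢b : a ≢ b) where

  open import Data.Fin using (punchIn; punchOut)
  open import Data.Fin.Properties
    using (_≟_; punchIn-injective; punchInᵢ≢i; punchIn-punchOut; punchOut-punchIn; punchOut-cong)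
  open import Data.Sum using (_⊎_; inj₁; inj₂)
  open import Data.Empty using (⊥-elim)
  open import Relation.Nullary using (Dec; yes; no)
  open import Relation.Binary.PropositionalEquality using (refl; sym; trans; cong)
  open import Function.Base using (_∘_)
  open import Function.Definitions using (Injective)

  private
    b≢a : b ≢ a
    b≢a = a≢b ∘ sym

  φ : Fin (suc n) → Fin n
  φ x with x ≟ b
  ... | yes _   = punchOut b≢a
  ... | no  x≢b = punchOut (x≢b ∘ sym)

  ψ : Fin n → Fin (suc n)
  ψ = punchIn b

  ψ-injective : Injective _≡_ _≡_ ψ
  ψ-injective = punchIn-injective b _ _

  φa≡φb : φ a ≡ φ b
  φa≡φb with a ≟ b | b ≟ b
  ... | yes a≡b | _       = ⊥-elim (a≢b a≡b)
  ... | no  _   | no  b≢b = ⊥-elim (b≢b refl)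
  ... | no  _   | yes _   = punchOut-cong b refl

  φ∘ψ : ∀ y → φ (ψ y) ≡ y
  φ∘ψ y with ψ y ≟ b
  ... | yes ψy≡b = ⊥-elim (punchInᵢ≢i b y ψy≡b)
  ... | no  _    = trans (punchOut-cong b refl) (punchOut-punchIn b)

  ψ∘φ-≢b : ∀ {x} → x ≢ b → ψ (φ x) ≡ x
  ψ∘φ-≢b {x} x≢b with x ≟ b
  ... | yes x≡b = ⊥-elim (x≢b x≡b)
  ... | no  _   = punchIn-punchOut _

  ψ∘φ-b : ψ (φ b) ≡ a
  ψ∘φ-b = trans (cong ψ (sym φa≡φb)) (ψ∘φ-≢b a≢b)

  φ-fiber : ∀ {x} → φ x ≡ φ a → x ≡ a ⊎ x ≡ b
  φ-fiber {x} φx≡φa = case-b (x ≟ b)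
    where
    case-b : Dec (x ≡ b) → x ≡ a ⊎ x ≡ b
    case-b (yes x≡b) = inj₂ x≡b
    case-b (no  x≢b) = inj₁ (trans (sym (ψ∘φ-≢b x≢b)) (trans (cong ψ φx≡φa) (ψ∘φ-≢b a≢b)))

  φ≡⇒≡ψ : ∀ {x y} → φ x ≡ y → y ≢ φ a → x ≡ ψ y
  φ≡⇒≡ψ {x} {y} φx≡y y≢φa = case-b (x ≟ b)
    where
    case-b : Dec (x ≡ b) → x ≡ ψ y
    case-b (yes x≡b) = ⊥-elim (y≢φa (trans (sym φx≡y) (trans (cong φ x≡b) (sym φa≡φb))))
    case-b (no  x≢b) = trans (sym (ψ∘φ-≢b x≢b)) (cong ψ φx≡y)

module Contraction {n m : ℕ} (Γ : SignedGraph (suc n) (suc m)) (e₀ : Fin (suc m))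
       (a≢b : SignedGraph.end Γ e₀ false ≢ SignedGraph.end Γ e₀ true) where

  open import Data.Fin using (punchIn; punchOut)
  open import Data.Fin.Properties using (_≟_; punchIn-injective; punchIn-punchOut)
  open import Data.Bool using (false; true)
  open import Data.Product using (_,_)
  open import Data.Sum using (inj₁; inj₂)
  open import Relation.Nullary using (Dec; yes; no)
  open import Relation.Binary.PropositionalEquality using (refl; sym; subst)
  open import Relation.Binary.Construct.Closure.ReflexiveTransitive using (_◅◅_; _◅_; reverse) renaming (ε to ε*)
  open import Function.Base using (_∘_)
  open import Function.Definitions using (Injective)
  open SignedGraph Γ
  open GraphOperations
  open MergeVertices a≢b public

  a b : Fin (suc n)
  a = end e₀ false
  b = end e₀ true

  ι : Fin m → Fin (suc m)
  ι = punchIn e₀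

  ι-injective : Injective _≡_ _≡_ ι
  ι-injective = punchIn-injective e₀ _ _

  Γ′ : SignedGraph n m
  Γ′ = relabel φ (Γ ∖ e₀)

  ψ∘φ-connected : ∀ x → Connected Γ (ψ (φ x)) x
  ψ∘φ-connected x = case-b (x ≟ b)
    where
    case-b : Dec (x ≡ b) → Connected Γ (ψ (φ x)) x
    case-b (yes refl) = subst (λ z → Connected Γ z b) (sym ψ∘φ-b) ((e₀ , inj₁ (refl , refl)) ◅ ε*)
    case-b (no  x≢b)  = subst (λ z → Connected Γ z x) (sym (ψ∘φ-≢b x≢b)) ε*

  connected-ψ∘φ : ∀ x → Connected Γ x (ψ (φ x))
  connected-ψ∘φ x = reverse (Adj-sym Γ) (ψ∘φ-connected x)

  φ∘ψ-connected : ∀ y → Connected Γ′ (φ (ψ y)) y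
  φ∘ψ-connected y = subst (λ z → Connected Γ′ z y) (sym (φ∘ψ y)) ε*

  φ-joins : ∀ {e x y} → Joins Γ (ι e) x y → Joins Γ′ e (φ x) (φ y)
  φ-joins (inj₁ (refl , refl)) = inj₁ (refl , refl)
  φ-joins (inj₂ (refl , refl)) = inj₂ (refl , refl)

  φ-adj : ∀ {x y} → Adj Γ x y → Connected Γ′ (φ x) (φ y)
  φ-adj {x} {y} (e , j) with e₀ ≟ e
  φ-adj (_ , inj₁ (refl , refl)) | yes refl = subst (Connected Γ′ (φ a)) φa≡φb ε*
  φ-adj (_ , inj₂ (refl , refl)) | yes refl = subst (λ z → Connected Γ′ z (φ a)) φa≡φb ε*
  ... | no e₀≢e =
    (punchOut e₀≢e , φ-joins (subst (λ z → Joins Γ z x y) (sym (punchIn-punchOut e₀≢e)) j)) ◅ ε*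

  φ-connected : ∀ {x y} → Connected Γ x y → Connected Γ′ (φ x) (φ y)
  φ-connected ε*        = ε*
  φ-connected (s ◅ x~y) = φ-adj s ◅◅ φ-connected x~y

  ψ-adj : ∀ {x y} → Adj Γ′ x y → Connected Γ (ψ x) (ψ y)
  ψ-adj (e , inj₁ (refl , refl)) = ψ∘φ-connected _ ◅◅ ((ι e , inj₁ (refl , refl)) ◅ connected-ψ∘φ _)
  ψ-adj (e , inj₂ (refl , refl)) = ψ∘φ-connected _ ◅◅ ((ι e , inj₂ (refl , refl)) ◅ connected-ψ∘φ _)

  ψ-connected : ∀ {x y} → Connected Γ′ x y → Connected Γ (ψ x) (ψ y)
  ψ-connected ε*        = ε*
  ψ-connected (s ◅ x~y) = ψ-adj s ◅◅ ψ-connected x~y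

module ContractionBalance {n m : ℕ} (Γ : SignedGraph (suc n) (suc m)) (e₀ : Fin (suc m))
       (a≢b : SignedGraph.end Γ e₀ false ≢ SignedGraph.end Γ e₀ true)
       (e₀-positive : SignedGraph.sign Γ e₀ ≡ Sign.+) where

  open import Data.Nat using (zero)
  open import Data.Fin using (zero; suc; punchOut; inject₁; fromℕ; toℕ)
  open import Data.Fin.Properties using (_≟_; punchInᵢ≢i; punchIn-punchOut; any?)
  open import Data.Sign using () renaming (_*_ to _·_)
  open import Data.Sign.Properties using (s*s≡+)
  open import Data.Product using (_,_)
  open import Data.Sum using (inj₁; inj₂)
  open import Data.Empty using (⊥-elim)
  open import Relation.Nullary using (¬_; Dec; yes; no)
  open import Relation.Binary.PropositionalEquality using (refl; sym; trans; cong; subst)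
  open import Relation.Binary.Construct.Closure.ReflexiveTransitive using (_◅◅_)
  open import Function.Base using (_∘_)
  open import Function.Bundles using (Inverse)
  open import Function.Definitions using (Injective)
  open SignedGraph Γ
  open Contraction Γ e₀ a≢b
  open CyclicOrder
  open Components
  private
    module C = Cycles Γ
    module C′ = Cycles Γ′

  switchingBalanced-lift : ∀ {y} → C′.SwitchingBalanced y → C.SwitchingBalanced (ψ y)
  switchingBalanced-lift {y} (s′ , sign≡) = s′ ∘ φ , λ e ψy~e → edge e ψy~e (e₀ ≟ e)
    where
    edge : ∀ e → Connected Γ (ψ y) (end e false) → Dec (e₀ ≡ e) →
           sign e ≡ s′ (φ (end e false)) · s′ (φ (end e true))
    edge _ _ (yes refl) =
      trans e₀-positive (sym (trans (cong (λ z → s′ z · s′ (φ b)) φa≡φb) (s*s≡+ (s′ (φ b)))))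
    edge e ψy~e (no e₀≢e) =
      subst (λ z → sign z ≡ s′ (φ (end z false)) · s′ (φ (end z true))) (punchIn-punchOut e₀≢e)
            (sign≡ (punchOut e₀≢e) (subst (λ z → Connected Γ′ z _) (φ∘ψ y) (φ-connected ψy~e′)))
      where
      ψy~e′ : Connected Γ (ψ y) (end (ι (punchOut e₀≢e)) false)
      ψy~e′ = subst (λ z → Connected Γ (ψ y) (end z false)) (sym (punchIn-punchOut e₀≢e)) ψy~e

  ψ-joins : ∀ {e y₁ y₂} → Joins Γ′ e y₁ y₂ → y₁ ≢ φ a → y₂ ≢ φ a → Joins Γ (ι e) (ψ y₁) (ψ y₂)
  ψ-joins (inj₁ (p , q)) y₁≢ y₂≢ = inj₁ (φ≡⇒≡ψ p y₁≢ , φ≡⇒≡ψ q y₂≢)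
  ψ-joins (inj₂ (p , q)) y₁≢ y₂≢ = inj₂ (φ≡⇒≡ψ p y₂≢ , φ≡⇒≡ψ q y₁≢)

  lift-avoiding : ∀ {k} (C : Cycle Γ′ k) → (∀ j → Cycle.vs C j ≢ φ a) → Cycle Γ k
  lift-avoiding C avoid = C.cycle (ψ ∘ vs) (ι ∘ es) (vs-inj ∘ ψ-injective) (es-inj ∘ ι-injective)
                            (λ i → ψ-joins (C′.cycleStep C i) (avoid i) (avoid (cyclicSuc i)))
    where open Cycle C

  record LiftedStep (e : Fin m) (y₁ y₂ : Fin n) : Set where
    field
      source target : Fin (suc n)
      joins         : Joins Γ (ι e) source target
      φ-source      : φ source ≡ y₁
      φ-target      : φ target ≡ y₂

  lift-step : ∀ {e y₁ y₂} → Joins Γ′ e y₁ y₂ → LiftedStep e y₁ y₂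
  lift-step {e} (inj₁ (p , q)) = record { joins = inj₁ (refl , refl) ; φ-source = p ; φ-target = q }
  lift-step {e} (inj₂ (p , q)) = record { joins = inj₂ (refl , refl) ; φ-source = q ; φ-target = p }

  -- A cycle through the merged vertex lifts with the same edges when its lifted ends p and q agree;
  -- otherwise p and q are the two ends of e₀, which closes it up.
  module Through {k : ℕ} (C : Cycle Γ′ k) (vs₀≡φa : Cycle.vs C zero ≡ φ a) where
    open Cycle C
    private module L (i : Fin (suc k)) = LiftedStep (lift-step (C′.cycleStep C i))

    source target : Fin (suc k) → Fin (suc n)
    source = L.source
    target = L.target

    p q : Fin (suc n)
    p = target (fromℕ k)
    q = source zero

    vs≢φa : ∀ {i} → i ≢ zero → vs i ≢ φ a
    vs≢φa i≢0 vsi≡φa = i≢0 (vs-inj (trans vsi≡φa (sym vs₀≡φa)))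

    source-injective : Injective _≡_ _≡_ source
    source-injective eq = vs-inj (trans (sym (L.φ-source _)) (trans (cong φ eq) (L.φ-source _)))

    target-inject₁ : ∀ j → target (inject₁ j) ≡ source (suc j)
    target-inject₁ j = trans (φ≡⇒≡ψ φt (vs≢φa λ ())) (sym (φ≡⇒≡ψ (L.φ-source (suc j)) (vs≢φa λ ())))
      where
      φt : φ (target (inject₁ j)) ≡ vs (suc j)
      φt = trans (L.φ-target (inject₁ j)) (cong vs (cyclicSuc-inject₁ j))

    φp≡φa : φ p ≡ φ a
    φp≡φa = trans (L.φ-target (fromℕ k)) (trans (cong vs (cyclicSuc-fromℕ k)) vs₀≡φa)

    φq≡φa : φ q ≡ φ a
    φq≡φa = trans (L.φ-source zero) vs₀≡φa

    ψ-connected-to : ∀ {x y} → φ x ≡ φ a → Connected Γ′ y (vs zero) → Connected Γ (ψ y) x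
    ψ-connected-to {x} φx≡φa y~C = subst (Connected Γ (ψ _) ∘ ψ) (trans vs₀≡φa (sym φx≡φa)) (ψ-connected y~C)
                                    ◅◅ ψ∘φ-connected x

    lifted-step : ∀ j → Joins Γ (ι (es (inject₁ j))) (source (inject₁ j)) (source (suc j))
    lifted-step j = subst (Joins Γ (ι (es (inject₁ j))) (source (inject₁ j))) (target-inject₁ j) (L.joins (inject₁ j))

    closed-cycle : p ≡ q → Cycle Γ k
    closed-cycle p≡q = record
      { vs = source ; es = ι ∘ es ; vs-inj = source-injective ; es-inj = es-inj ∘ ι-injective
      ; step = lifted-step ; close = subst (Joins Γ (ι (es (fromℕ k))) (source (fromℕ k))) p≡q (L.joins (fromℕ k)) }

    module _ (p≢q : p ≢ q) where

      e₀-joins : Joins Γ e₀ p q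
      e₀-joins with φ-fiber φp≡φa | φ-fiber φq≡φa
      ... | inj₁ p≡a | inj₁ q≡a = ⊥-elim (p≢q (trans p≡a (sym q≡a)))
      ... | inj₁ p≡a | inj₂ q≡b = inj₁ (sym p≡a , sym q≡b)
      ... | inj₂ p≡b | inj₁ q≡a = inj₂ (sym q≡a , sym p≡b)
      ... | inj₂ p≡b | inj₂ q≡b = ⊥-elim (p≢q (trans p≡b (sym q≡b)))

      extended-vs : Fin (suc (suc k)) → Fin (suc n)
      extended-vs zero    = p
      extended-vs (suc i) = source i

      extended-es : Fin (suc (suc k)) → Fin (suc m)
      extended-es zero    = e₀
      extended-es (suc i) = ι (es i)

      p≢source : ∀ i → p ≢ source i
      p≢source i p≡si = p≢q (trans p≡si (cong source i≡0))
        where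
        i≡0 : i ≡ zero
        i≡0 = vs-inj (trans (sym (L.φ-source i)) (trans (cong φ (sym p≡si)) (trans φp≡φa (sym vs₀≡φa))))

      extended-vs-injective : Injective _≡_ _≡_ extended-vs
      extended-vs-injective {zero}  {zero}  _  = refl
      extended-vs-injective {zero}  {suc j} eq = ⊥-elim (p≢source j eq)
      extended-vs-injective {suc i} {zero}  eq = ⊥-elim (p≢source i (sym eq))
      extended-vs-injective {suc i} {suc j} eq = cong suc (source-injective eq)

      extended-es-injective : Injective _≡_ _≡_ extended-es
      extended-es-injective {zero}  {zero}  _  = refl
      extended-es-injective {zero}  {suc j} eq = ⊥-elim (punchInᵢ≢i e₀ (es j) (sym eq))
      extended-es-injective {suc i} {zero}  eq = ⊥-elim (punchInᵢ≢i e₀ (es i) eq)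
      extended-es-injective {suc i} {suc j} eq = cong suc (es-inj (ι-injective eq))

      extended-cycle : Cycle Γ (suc k)
      extended-cycle = record
        { vs = extended-vs ; es = extended-es ; vs-inj = extended-vs-injective ; es-inj = extended-es-injective
        ; step = λ { zero → e₀-joins ; (suc j) → lifted-step j }
        ; close = L.joins (fromℕ k) }

    lift : ∀ {y} → ¬ Balanced Γ′ C → Connected Γ′ y (vs zero) → UnbalancedComp Γ (ψ y)
    lift ¬bal y~C with p ≟ q
    ... | yes p≡q = k , closed-cycle p≡q , ψ-connected-to φq≡φa y~C , ¬bal
    ... | no  p≢q = suc k , extended-cycle p≢q , ψ-connected-to φp≡φa y~C ,
                    ¬bal ∘ subst (λ s → s · C.Π (sign ∘ ι ∘ es) ≡ Sign.+) e₀-positive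

  unbalanced-lift : ∀ {y} → UnbalancedComp Γ′ y → UnbalancedComp Γ (ψ y)
  unbalanced-lift (k , C , y~C , ¬bal) with any? (λ j → Cycle.vs C j ≟ φ a)
  ... | no  avoid    = k , lift-avoiding C (λ j eq → avoid (j , eq)) , ψ-connected y~C , ¬bal
  ... | yes (j , vsj≡φa) =
    Through.lift (C′.rotate (toℕ j) C) (trans (cong (Cycle.vs C) (cyclicSuc^-toℕ j)) vsj≡φa)
      (¬bal ∘ trans (sym (C′.rotate-sign (toℕ j) C)))
      (y~C ◅◅ subst (Connected Γ′ (Cycle.vs C zero) ∘ Cycle.vs C) (sym (cyclicSuc^-toℕ j)) (C′.connected-along C j))

  module _ (dichotomy′ : C′.BalanceDichotomy) where

    dichotomy-lift : C.BalanceDichotomy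
    dichotomy-lift x with dichotomy′ (φ x)
    ... | inj₁ sb = inj₁ (C.switchingBalanced-resp (connected-ψ∘φ x) (switchingBalanced-lift sb))
    ... | inj₂ ub = inj₂ (C.unbalanced-resp (connected-ψ∘φ x) (unbalanced-lift ub))

    balanced-to : ∀ {x} → BalancedComp Γ x → BalancedComp Γ′ (φ x)
    balanced-to {x} bal with dichotomy′ (φ x)
    ... | inj₁ sb = C′.switchingBalanced⇒balanced sb
    ... | inj₂ ub = ⊥-elim (C.unbalanced⇒¬balanced (C.unbalanced-resp (connected-ψ∘φ x) (unbalanced-lift ub)) bal)

    balanced-from : ∀ {y} → BalancedComp Γ′ y → BalancedComp Γ (ψ y)
    balanced-from {y} bal with dichotomy′ y
    ... | inj₁ sb = C.switchingBalanced⇒balanced (switchingBalanced-lift sb)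
    ... | inj₂ ub = ⊥-elim (C′.unbalanced⇒¬balanced ub bal)

    unbalanced-to : ∀ {x} → UnbalancedComp Γ x → UnbalancedComp Γ′ (φ x)
    unbalanced-to {x} ub with dichotomy′ (φ x)
    ... | inj₁ sb = ⊥-elim (C.unbalanced⇒¬balanced ub (C.switchingBalanced⇒balanced
                             (C.switchingBalanced-resp (connected-ψ∘φ x) (switchingBalanced-lift sb))))
    ... | inj₂ ub′ = ub′

    balancedComps-inverse : Inverse (BalancedComps Γ) (BalancedComps Γ′)
    balancedComps-inverse =
      components-inverse φ ψ φ-connected ψ-connected φ∘ψ-connected ψ∘φ-connected balanced-to balanced-from

    unbalancedComps-inverse : Inverse (UnbalancedComps Γ) (UnbalancedComps Γ′)
    unbalancedComps-inverse =
      components-inverse φ ψ φ-connected ψ-connected φ∘ψ-connected ψ∘φ-connected unbalanced-to unbalanced-lift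

module ContractionFlows {n m : ℕ} (Γ : SignedGraph (suc n) (suc m)) (e₀ : Fin (suc m))
       (a≢b : SignedGraph.end Γ e₀ false ≢ SignedGraph.end Γ e₀ true)
       (e₀-positive : SignedGraph.sign Γ e₀ ≡ Sign.+)
       {c ℓ} (G : AbelianGroup c ℓ) (ω : Orientation Γ) (compat : Compatible Γ ω) where

  open import Data.Fin using (punchOut)
  open import Data.Fin.Properties using (_≟_; punchIn-punchOut; punchInᵢ≢i)
  open import Data.Sign using (opposite)
  open import Data.Product using (_,_; proj₁)
  open import Data.Sum using ([_,_]′)
  open import Relation.Nullary using (Dec; yes; no)
  open import Relation.Binary.PropositionalEquality as ≡ using ()
  open import Data.Vec.Functional using (insertAt; removeAt)
  open import Data.Vec.Functional.Properties using (insertAt-lookup; insertAt-punchIn; insertAt-removeAt)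
  open import Function.Base using (_∘_)
  open import Function.Bundles using (Inverse)
  open SignedGraph Γ
  open Contraction Γ e₀ a≢b
  open GraphOperations
  open AbelianGroup G
  open GroupSums G
  open Boundary G
  open SignAlgebra using (opposite[s·t]≡+)
  open import Algebra.Properties.CommutativeSemigroup commutativeSemigroup using (interchange)
  open import Relation.Binary.Reasoning.Setoid setoid

  Δ : SignedGraph (suc n) m
  Δ = Γ ∖ e₀

  ω′ : Orientation Δ
  ω′ = restrictOrientation Γ e₀ ω

  insertAt-cong : ∀ {f g : Fin m → Carrier} {x y} → (∀ e → f e ≈ g e) → x ≈ y →
                  ∀ e → insertAt f e₀ x e ≈ insertAt g e₀ y e
  insertAt-cong {f} {g} {x} {y} f≈g x≈y e with e₀ ≟ e
  ... | yes ≡.refl = begin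
    insertAt f e₀ x e₀ ≡⟨ insertAt-lookup f e₀ x ⟩
    x                  ≈⟨ x≈y ⟩
    y                  ≡⟨ insertAt-lookup g e₀ y ⟨
    insertAt g e₀ y e₀ ∎
  ... | no e₀≢e = begin
    insertAt f e₀ x e                      ≡⟨ ≡.cong (insertAt f e₀ x) (punchIn-punchOut e₀≢e) ⟨
    insertAt f e₀ x (ι (punchOut e₀≢e))    ≡⟨ insertAt-punchIn f e₀ x _ ⟩
    f (punchOut e₀≢e)                      ≈⟨ f≈g _ ⟩
    g (punchOut e₀≢e)                      ≡⟨ insertAt-punchIn g e₀ y _ ⟨
    insertAt g e₀ y (ι (punchOut e₀≢e))    ≡⟨ ≡.cong (insertAt g e₀ y) (punchIn-punchOut e₀≢e) ⟩
    insertAt g e₀ y e                      ∎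

  ω-a≡opposite-ω-b : ω e₀ false ≡ opposite (ω e₀ true)
  ω-a≡opposite-ω-b = opposite[s·t]≡+ _ _ (≡.trans (≡.sym (compat e₀)) e₀-positive)

  edgeTerm-a : ∀ f → edgeTerm Γ ω f a e₀ ≈ ω e₀ false ⊛ f e₀
  edgeTerm-a f = trans (reflexive (≡.cong₂ _∙_ (onlyAt-≡ {x = a} _ ≡.refl) (onlyAt-≢ _ (a≢b ∘ ≡.sym)))) (identityʳ _)

  edgeTerm-b : ∀ f → edgeTerm Γ ω f b e₀ ≈ ω e₀ true ⊛ f e₀
  edgeTerm-b f = trans (reflexive (≡.cong₂ _∙_ (onlyAt-≢ _ a≢b) (onlyAt-≡ {x = b} _ ≡.refl))) (identityˡ _)

  edgeTerm-elsewhere : ∀ f {v} → a ≢ v → b ≢ v → edgeTerm Γ ω f v e₀ ≈ ε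
  edgeTerm-elsewhere f a≢v b≢v = trans (reflexive (≡.cong₂ _∙_ (onlyAt-≢ _ a≢v) (onlyAt-≢ _ b≢v))) (identityˡ ε)

  edgeTerm-a∙b : ∀ f → edgeTerm Γ ω f a e₀ ∙ edgeTerm Γ ω f b e₀ ≈ ε
  edgeTerm-a∙b f = begin
    edgeTerm Γ ω f a e₀ ∙ edgeTerm Γ ω f b e₀       ≈⟨ ∙-cong (edgeTerm-a f) (edgeTerm-b f) ⟩
    ω e₀ false ⊛ f e₀ ∙ ω e₀ true ⊛ f e₀            ≡⟨ ≡.cong (λ s → s ⊛ f e₀ ∙ ω e₀ true ⊛ f e₀) ω-a≡opposite-ω-b ⟩
    opposite (ω e₀ true) ⊛ f e₀ ∙ ω e₀ true ⊛ f e₀  ≈⟨ opposite-⊛-inverse (ω e₀ true) (f e₀) ⟩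
    ε                                              ∎

  ∂′-unmerged : ∀ f′ {y} → y ≢ φ a → ∂ Γ′ ω′ f′ y ≈ ∂ Δ ω′ f′ (ψ y)
  ∂′-unmerged f′ y≢φa = ∂-relabel-fiber₁ Δ ω′ φ (λ x φx≡y → φ≡⇒≡ψ φx≡y y≢φa) (φ∘ψ _) f′

  ∂′-merged : ∀ f′ → ∂ Γ′ ω′ f′ (φ a) ≈ ∂ Δ ω′ f′ a ∙ ∂ Δ ω′ f′ b
  ∂′-merged f′ = ∂-relabel-fiber₂ Δ ω′ φ a≢b (λ x → φ-fiber) ≡.refl (≡.sym φa≡φb) f′

  ∂-unmerged : ∀ f {y} → y ≢ φ a → ∂ Γ ω f (ψ y) ≈ ∂ Γ′ ω′ (removeAt f e₀) y
  ∂-unmerged f {y} y≢φa = begin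
    ∂ Γ ω f (ψ y)                                              ≈⟨ ∂-delete Γ ω e₀ f (ψ y) ⟩
    edgeTerm Γ ω f (ψ y) e₀ ∙ ∂ Δ ω′ (removeAt f e₀) (ψ y)     ≈⟨ ∙-congʳ (edgeTerm-elsewhere f a≢ψy b≢ψy) ⟩
    ε ∙ ∂ Δ ω′ (removeAt f e₀) (ψ y)                           ≈⟨ identityˡ _ ⟩
    ∂ Δ ω′ (removeAt f e₀) (ψ y)                               ≈⟨ ∂′-unmerged (removeAt f e₀) y≢φa ⟨
    ∂ Γ′ ω′ (removeAt f e₀) y                                  ∎
    where
    a≢ψy : a ≢ ψ y
    a≢ψy a≡ψy = y≢φa (≡.trans (≡.sym (φ∘ψ y)) (≡.cong φ (≡.sym a≡ψy)))
    b≢ψy : b ≢ ψ y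
    b≢ψy b≡ψy = punchInᵢ≢i b y (≡.sym b≡ψy)

  ∂-merged : ∀ f → ∂ Γ ω f a ∙ ∂ Γ ω f b ≈ ∂ Γ′ ω′ (removeAt f e₀) (φ a)
  ∂-merged f = begin
    ∂ Γ ω f a ∙ ∂ Γ ω f b                                              ≈⟨ ∙-cong (∂-delete Γ ω e₀ f a) (∂-delete Γ ω e₀ f b) ⟩
    (edgeTerm Γ ω f a e₀ ∙ ∂ Δ ω′ f′ a) ∙ (edgeTerm Γ ω f b e₀ ∙ ∂ Δ ω′ f′ b) ≈⟨ interchange _ _ _ _ ⟩
    (edgeTerm Γ ω f a e₀ ∙ edgeTerm Γ ω f b e₀) ∙ (∂ Δ ω′ f′ a ∙ ∂ Δ ω′ f′ b) ≈⟨ ∙-congʳ (edgeTerm-a∙b f) ⟩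
    ε ∙ (∂ Δ ω′ f′ a ∙ ∂ Δ ω′ f′ b)                                    ≈⟨ identityˡ _ ⟩
    ∂ Δ ω′ f′ a ∙ ∂ Δ ω′ f′ b                                          ≈⟨ ∂′-merged f′ ⟨
    ∂ Γ′ ω′ f′ (φ a)                                                   ∎
    where
    f′ : Fin m → Carrier
    f′ = removeAt f e₀

  restrict-flow : ∀ f → IsFlow G Γ ω f → IsFlow G Γ′ ω′ (removeAt f e₀)
  restrict-flow f flow y with y ≟ φ a
  ... | yes ≡.refl = trans (sym (∂-merged f)) (trans (∙-cong (flow a) (flow b)) (identityˡ ε))
  ... | no  y≢φa   = trans (sym (∂-unmerged f y≢φa)) (flow (ψ y))

  -- forced by the flow condition at a
  e₀-value : (Fin m → Carrier) → Carrier
  e₀-value f′ = ω e₀ false ⊛ (∂ Δ ω′ f′ a ⁻¹)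

  e₀-value-cong : ∀ {f′ g′} → (∀ e → f′ e ≈ g′ e) → e₀-value f′ ≈ e₀-value g′
  e₀-value-cong f′≈g′ = ⊛-cong (ω e₀ false) (⁻¹-cong (∂-cong Δ ω′ f′≈g′ a))

  extend : (Fin m → Carrier) → Fin (suc m) → Carrier
  extend f′ = insertAt f′ e₀ (e₀-value f′)

  restrict-extend : ∀ f′ e → removeAt (extend f′) e₀ e ≈ f′ e
  restrict-extend f′ e = reflexive (insertAt-punchIn f′ e₀ (e₀-value f′) e)

  ∂-a : ∀ f → ∂ Γ ω f a ≈ ω e₀ false ⊛ f e₀ ∙ ∂ Δ ω′ (removeAt f e₀) a
  ∂-a f = trans (∂-delete Γ ω e₀ f a) (∙-congʳ (edgeTerm-a f))

  e₀-value-restrict : ∀ f → IsFlow G Γ ω f → e₀-value (removeAt f e₀) ≈ f e₀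
  e₀-value-restrict f flow = sym (⊛-inverseˡ-unique (ω e₀ false) (trans (sym (∂-a f)) (flow a)))

  extend-flow : ∀ f′ → IsFlow G Γ′ ω′ f′ → IsFlow G Γ ω (extend f′)
  extend-flow f′ flow′ v = cases (v ≟ a) (v ≟ b)
    where
    F : Fin (suc m) → Carrier
    F = extend f′
    F∖e₀≈f′ : ∀ e → removeAt F e₀ e ≈ f′ e
    F∖e₀≈f′ = restrict-extend f′
    ∂F-a : ∂ Γ ω F a ≈ ε
    ∂F-a = begin
      ∂ Γ ω F a                                          ≈⟨ ∂-a F ⟩
      ω e₀ false ⊛ F e₀ ∙ ∂ Δ ω′ (removeAt F e₀) a       ≈⟨ ∙-cong (reflexive (≡.cong (ω e₀ false ⊛_) (insertAt-lookup f′ e₀ _)))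
                                                                    (∂-cong Δ ω′ F∖e₀≈f′ a) ⟩
      ω e₀ false ⊛ e₀-value f′ ∙ ∂ Δ ω′ f′ a             ≈⟨ ⊛-involutive-inverseˡ (ω e₀ false) (∂ Δ ω′ f′ a) ⟩
      ε                                                  ∎
    ∂F-b : ∂ Γ ω F b ≈ ε
    ∂F-b = ∙-cancel-ε (trans (∂-merged F) (trans (∂-cong Γ′ ω′ F∖e₀≈f′ (φ a)) (flow′ (φ a)))) ∂F-a
    cases : Dec (v ≡ a) → Dec (v ≡ b) → ∂ Γ ω F v ≈ ε
    cases (yes ≡.refl) _           = ∂F-a
    cases (no _)       (yes ≡.refl) = ∂F-b
    cases (no v≢a)     (no v≢b)    = begin
      ∂ Γ ω F v                    ≡⟨ ≡.cong (∂ Γ ω F) (ψ∘φ-≢b v≢b) ⟨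
      ∂ Γ ω F (ψ (φ v))            ≈⟨ ∂-unmerged F φv≢φa ⟩
      ∂ Γ′ ω′ (removeAt F e₀) (φ v) ≈⟨ ∂-cong Γ′ ω′ F∖e₀≈f′ (φ v) ⟩
      ∂ Γ′ ω′ f′ (φ v)             ≈⟨ flow′ (φ v) ⟩
      ε                            ∎
      where
      φv≢φa : φ v ≢ φ a
      φv≢φa φv≡φa = [ v≢a , v≢b ]′ (φ-fiber φv≡φa)

  flows-inverse : Inverse (FlowSetoid G Γ ω) (FlowSetoid G Γ′ ω′)
  flows-inverse = record
    { to = λ { (f , flow) → removeAt f e₀ , restrict-flow f flow }
    ; from = λ { (f′ , flow′) → extend f′ , extend-flow f′ flow′ }
    ; to-cong = λ f≈g e → f≈g (ι e)
    ; from-cong = λ f′≈g′ → insertAt-cong f′≈g′ (e₀-value-cong f′≈g′)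
    ; inverse = (λ {f′} f≈ e → trans (f≈ (ι e)) (restrict-extend (proj₁ f′) e))
              , (λ { {f , flow} f′≈ e → extend-restrict f flow f′≈ e }) }
    where
    extend-restrict : ∀ f → IsFlow G Γ ω f → ∀ {f′} → (∀ e → f′ e ≈ removeAt f e₀ e) → ∀ e → extend f′ e ≈ f e
    extend-restrict f flow {f′} f′≈ e = begin
      extend f′ e                          ≈⟨ insertAt-cong f′≈ (trans (e₀-value-cong f′≈) (e₀-value-restrict f flow)) e ⟩
      insertAt (removeAt f e₀) e₀ (f e₀) e ≡⟨ insertAt-removeAt f e₀ e ⟩
      f e                                  ∎

module Halving {c ℓ} (G : AbelianGroup c ℓ) {g : ℕ} (card : HasCard (AbelianGroup.setoid G) g) where

  open import Data.Fin.Properties using (_≟_)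
  open import Data.Product using (∃; _×_; _,_)
  open import Data.Product.Relation.Binary.Pointwise.NonDependent using (_×ₛ_)
  open import Relation.Nullary using (Dec; yes; no)
  open import Relation.Binary.PropositionalEquality as ≡ using ()
  open import Function.Base using (_∘_)
  open import Function.Bundles using (Inverse)
  import Function.Construct.Composition as Comp
  open AbelianGroup G
  open import Algebra.Properties.AbelianGroup G using (⁻¹-∙-comm)
  open import Algebra.Properties.CommutativeSemigroup commutativeSemigroup using (interchange)
  open import Relation.Binary.Reasoning.Setoid setoid
  open Cardinality
  open GroupSums G using (TwoTorsion)
  private module I = Inverse card

  _≈?_ : ∀ x y → Dec (x ≈ y)
  x ≈? y with I.to x ≟ I.to y
  ... | yes eq = yes (trans (sym (I.inverseʳ ≡.refl)) (trans (reflexive (≡.cong I.from eq)) (I.inverseʳ ≡.refl)))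
  ... | no  ne = no (ne ∘ I.to-cong)

  HasCard-TwoTorsion : ∃ (HasCard TwoTorsion)
  HasCard-TwoTorsion = HasCard-Subsetoid (λ x≈y x+x≈ε → trans (∙-cong (sym x≈y) (sym x≈y)) x+x≈ε) (λ x → (x ∙ x) ≈? ε) card

  -- the least half in the enumeration, so that the choice depends on y only
  half : ∀ y → ∃ (λ x → x ∙ x ≈ y) → Carrier
  half y (x , x+x≈y) = I.from (first (λ i → (I.from i ∙ I.from i) ≈? y) (I.to x , from-to-double))
    where
    from-to-double : I.from (I.to x) ∙ I.from (I.to x) ≈ y
    from-to-double = trans (∙-cong (I.inverseʳ ≡.refl) (I.inverseʳ ≡.refl)) x+x≈y

  half-double : ∀ y h → half y h ∙ half y h ≈ y
  half-double y _ = first-satisfies (λ i → (I.from i ∙ I.from i) ≈? y) _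

  half-cong : ∀ {y y′} h h′ → y ≈ y′ → half y h ≈ half y′ h′
  half-cong {y} {y′} _ _ y≈y′ = reflexive (≡.cong I.from
    (first-cong _ _ _ _ (λ i h → trans h y≈y′) (λ i h → trans h (sym y≈y′))))

  private
    canonicalHalf : Carrier → Carrier
    canonicalHalf x = half (x ∙ x) (x , refl)

    torsionPart : Carrier → Carrier
    torsionPart x = x ∙ canonicalHalf x ⁻¹

    torsionPart-torsion : ∀ x → torsionPart x ∙ torsionPart x ≈ ε
    torsionPart-torsion x = begin
      (x ∙ h ⁻¹) ∙ (x ∙ h ⁻¹) ≈⟨ interchange _ _ _ _ ⟩
      (x ∙ x) ∙ (h ⁻¹ ∙ h ⁻¹) ≈⟨ ∙-congˡ (⁻¹-∙-comm h h) ⟩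
      (x ∙ x) ∙ (h ∙ h) ⁻¹    ≈⟨ ∙-congˡ (⁻¹-cong (half-double _ _)) ⟩
      (x ∙ x) ∙ (x ∙ x) ⁻¹    ≈⟨ inverseʳ _ ⟩
      ε                       ∎
      where
      h : Carrier
      h = canonicalHalf x

  torsion×double : Inverse setoid (TwoTorsion ×ₛ TwoG G)
  torsion×double = record
    { to = λ x → (torsionPart x , torsionPart-torsion x) , (x ∙ x , x , refl)
    ; from = λ { ((k , _) , (y , h)) → k ∙ half y h }
    ; to-cong = λ x≈y → ∙-cong x≈y (⁻¹-cong (half-cong _ _ (∙-cong x≈y x≈y))) , ∙-cong x≈y x≈y
    ; from-cong = λ { {_ , (_ , h)} {_ , (_ , h′)} (k≈k′ , y≈y′) → ∙-cong k≈k′ (half-cong h h′ y≈y′) }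
    ; inverse = (λ { {(k , k+k≈ε) , (y , h)} x≈ → to-from k k+k≈ε y h x≈ })
              , (λ { {x} {(k , _) , (y , h)} (k≈ , y≈) → from-to x k y h k≈ y≈ }) }
    where
    to-from : ∀ k → k ∙ k ≈ ε → ∀ y h {x} → x ≈ k ∙ half y h → torsionPart x ≈ k × x ∙ x ≈ y
    to-from k k+k≈ε y h {x} x≈ = torsion , doubled
      where
      H : Carrier
      H = half y h
      doubled : x ∙ x ≈ y
      doubled = begin
        x ∙ x             ≈⟨ ∙-cong x≈ x≈ ⟩
        (k ∙ H) ∙ (k ∙ H) ≈⟨ interchange _ _ _ _ ⟩
        (k ∙ k) ∙ (H ∙ H) ≈⟨ ∙-cong k+k≈ε (half-double y h) ⟩
        ε ∙ y             ≈⟨ identityˡ y ⟩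
        y                 ∎
      torsion : torsionPart x ≈ k
      torsion = begin
        x ∙ canonicalHalf x ⁻¹ ≈⟨ ∙-cong x≈ (⁻¹-cong (half-cong _ h doubled)) ⟩
        (k ∙ H) ∙ H ⁻¹         ≈⟨ assoc _ _ _ ⟩
        k ∙ (H ∙ H ⁻¹)         ≈⟨ ∙-congˡ (inverseʳ H) ⟩
        k ∙ ε                  ≈⟨ identityʳ k ⟩
        k                      ∎
    from-to : ∀ x k y h → k ≈ torsionPart x → y ≈ x ∙ x → k ∙ half y h ≈ x
    from-to x k y h k≈ y≈ = begin
      k ∙ half y h                               ≈⟨ ∙-cong k≈ (half-cong h (x , refl) y≈) ⟩
      (x ∙ canonicalHalf x ⁻¹) ∙ canonicalHalf x ≈⟨ assoc _ _ _ ⟩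
      x ∙ (canonicalHalf x ⁻¹ ∙ canonicalHalf x) ≈⟨ ∙-congˡ (inverseˡ _) ⟩
      x ∙ ε                                      ≈⟨ identityʳ x ⟩
      x                                          ∎

  card-decomposition : ∀ {t h} → HasCard TwoTorsion t → HasCard (TwoG G) h → g ≡ t * h
  card-decomposition T H = HasCard-unique card (Comp.inverse torsion×double (HasCard-× T H))

module LoopGraph {n m : ℕ} (Γ : SignedGraph n m) (loops : GraphOperations.AllLoops Γ) where

  open import Data.Nat using (zero; suc)
  open import Data.Nat.Properties using (+-comm)
  open import Data.Fin using (zero; suc)
  open import Data.Fin.Properties using (_≟_; any?)
  open import Data.Sign using () renaming (_*_ to _·_)
  open import Data.Sign.Properties using () renaming (_≟_ to _≟ₛ_)
  open import Data.Product using (∃; _×_; _,_)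
  open import Data.Sum using (inj₁; inj₂)
  open import Data.Empty using (⊥-elim)
  open import Relation.Nullary using (¬_; yes; no; ¬?)
  open import Relation.Nullary.Decidable using (_×-dec_)
  open import Relation.Unary using (Decidable)
  open import Relation.Binary.PropositionalEquality using (refl; sym; trans; cong)
  open import Relation.Binary.Construct.Closure.ReflexiveTransitive using (_◅_) renaming (ε to ε*)
  open import Function.Base using (_∘_)
  open import Function.Bundles using (Inverse)
  import Function.Construct.Composition as Comp
  open SignedGraph Γ
  open Cardinality
  open Components using (ComponentsWith)
  private module C = Cycles Γ

  adjacent⇒≡ : ∀ {x y} → Adj Γ x y → x ≡ y
  adjacent⇒≡ (e , inj₁ (p , q)) = trans (sym p) (trans (loops e) q)
  adjacent⇒≡ (e , inj₂ (p , q)) = trans (sym q) (trans (sym (loops e)) p)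

  connected⇒≡ : ∀ {x y} → Connected Γ x y → x ≡ y
  connected⇒≡ ε*         = refl
  connected⇒≡ (s ◅ x~y) = trans (adjacent⇒≡ s) (connected⇒≡ x~y)

  NegativeLoopAt : Fin n → Set
  NegativeLoopAt v = ∃ λ e → end e false ≡ v × sign e ≡ Sign.-

  negativeLoopAt? : Decidable NegativeLoopAt
  negativeLoopAt? v = any? (λ e → (end e false ≟ v) ×-dec (sign e ≟ₛ Sign.-))

  cycle-length : ∀ {k} → Cycle Γ k → k ≡ 0
  cycle-length {zero}  C = refl
  cycle-length {suc k} C with Cycle.vs-inj C (adjacent⇒≡ (_ , Cycle.step C zero))
  ... | ()

  unbalanced⇒negativeLoop : ∀ {v} → UnbalancedComp Γ v → NegativeLoopAt v
  unbalanced⇒negativeLoop (k , C , v~C , ¬bal) with cycle-length C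
  ... | refl = es zero , trans (loop-end close) (sym (connected⇒≡ v~C)) , negative (sign (es zero)) ¬bal
    where
    open Cycle C
    loop-end : ∀ {e x} → Joins Γ e x x → end e false ≡ x
    loop-end (inj₁ (p , _)) = p
    loop-end (inj₂ (p , _)) = p
    negative : ∀ s → ¬ s · Sign.+ ≡ Sign.+ → s ≡ Sign.-
    negative Sign.+ s≢+ = ⊥-elim (s≢+ refl)
    negative Sign.- _   = refl

  negativeLoop⇒unbalanced : ∀ {v} → NegativeLoopAt v → UnbalancedComp Γ v
  negativeLoop⇒unbalanced {v} (e , e-at-v , e-negative) = 0 , loop , ε* , ¬balanced e-negative
    where
    loop : Cycle Γ 0
    loop = record
      { vs = λ _ → v ; es = λ _ → e
      ; vs-inj = λ { {zero} {zero} _ → refl } ; es-inj = λ { {zero} {zero} _ → refl }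
      ; step = λ () ; close = inj₁ (e-at-v , trans (sym (loops e)) e-at-v) }
    ¬balanced : ∀ {s} → s ≡ Sign.- → ¬ s · Sign.+ ≡ Sign.+
    ¬balanced refl ()

  ¬negativeLoop⇒switchingBalanced : ∀ {v} → ¬ NegativeLoopAt v → C.SwitchingBalanced v
  ¬negativeLoop⇒switchingBalanced {v} ¬neg = (λ _ → Sign.+) , positive
    where
    positive : ∀ e → Connected Γ v (end e false) → sign e ≡ Sign.+
    positive e v~e with sign e in eq
    ... | Sign.+ = refl
    ... | Sign.- = ⊥-elim (¬neg (e , sym (connected⇒≡ v~e) , eq))

  dichotomy : C.BalanceDichotomy
  dichotomy v with negativeLoopAt? v
  ... | yes neg = inj₂ (negativeLoop⇒unbalanced neg)
  ... | no ¬neg = inj₁ (¬negativeLoop⇒switchingBalanced ¬neg)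

  components≅vertices : ∀ {P Q : Fin n → Set} → (∀ {v} → P v → Q v) → (∀ {v} → Q v → P v) →
                        Inverse (ComponentsWith Γ P) (FinSubsetoid n Q)
  components≅vertices P⇒Q Q⇒P = record
    { to = λ { (v , p) → v , P⇒Q p } ; from = λ { (v , q) → v , Q⇒P q }
    ; to-cong = connected⇒≡ ; from-cong = λ { refl → ε* }
    ; inverse = connected⇒≡ , λ { refl → ε* } }

  negativeLoops : ℕ
  negativeLoops = count negativeLoopAt?

  unbalancedComps-count : ∀ {ku} → HasCard (UnbalancedComps Γ) ku → ku ≡ negativeLoops
  unbalancedComps-count card = HasCard-unique card
    (Comp.inverse (components≅vertices unbalanced⇒negativeLoop negativeLoop⇒unbalanced) (HasCard-count negativeLoopAt?))

  balancedComps-count : ∀ {kb} → HasCard (BalancedComps Γ) kb → kb + negativeLoops ≡ n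
  balancedComps-count {kb} card = trans (cong (_+ negativeLoops) kb≡) (trans (+-comm _ negativeLoops) (count-+-∁ negativeLoopAt?))
    where
    balanced⇒¬negativeLoop : ∀ {v} → BalancedComp Γ v → ¬ NegativeLoopAt v
    balanced⇒¬negativeLoop bal neg = C.unbalanced⇒¬balanced (negativeLoop⇒unbalanced neg) bal
    ¬negativeLoop⇒balanced : ∀ {v} → ¬ NegativeLoopAt v → BalancedComp Γ v
    ¬negativeLoop⇒balanced = C.switchingBalanced⇒balanced ∘ ¬negativeLoop⇒switchingBalanced
    kb≡ : kb ≡ count (λ v → ¬? (negativeLoopAt? v))
    kb≡ = HasCard-unique card (Comp.inverse (components≅vertices balanced⇒¬negativeLoop ¬negativeLoop⇒balanced)
                                            (HasCard-count (λ v → ¬? (negativeLoopAt? v))))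

module LoopTerms {c ℓ} (G : AbelianGroup c ℓ) {n m : ℕ} (Γ : SignedGraph n m) (loops : GraphOperations.AllLoops Γ)
       (ω : Orientation Γ) (compat : Compatible Γ ω) where

  open import Data.Fin.Properties using (_≟_)
  open import Relation.Nullary using (Dec; yes; no)
  open import Relation.Binary.PropositionalEquality as ≡ using ()
  open SignedGraph Γ
  open AbelianGroup G
  open GroupSums G
  open Boundary G
  open SignAlgebra using (opposite[s·t]≡+; opposite[s·t]≡-)
  open import Relation.Binary.Reasoning.Setoid setoid

  edgeTerm-loop : ∀ f v e → edgeTerm Γ ω f v e ≈ onlyAt (end e false) v (ω e false ⊛ f e ∙ ω e true ⊛ f e)
  edgeTerm-loop f v e = begin
    onlyAt (end e false) v (ω e false ⊛ f e) ∙ onlyAt (end e true) v (ω e true ⊛ f e)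
      ≡⟨ ≡.cong (λ x → onlyAt (end e false) v (ω e false ⊛ f e) ∙ onlyAt x v (ω e true ⊛ f e)) (loops e) ⟨
    onlyAt (end e false) v (ω e false ⊛ f e) ∙ onlyAt (end e false) v (ω e true ⊛ f e)
      ≈⟨ onlyAt-∙ (end e false) v _ _ ⟨
    onlyAt (end e false) v (ω e false ⊛ f e ∙ ω e true ⊛ f e)
      ∎

  edgeTerm-positiveLoop : ∀ f v e → sign e ≡ Sign.+ → edgeTerm Γ ω f v e ≈ ε
  edgeTerm-positiveLoop f v e positive =
    trans (edgeTerm-loop f v e) (trans (onlyAt-cong (end e false) v cancel) (onlyAt-ε (end e false) v))
    where
    cancel : ω e false ⊛ f e ∙ ω e true ⊛ f e ≈ ε
    cancel rewrite opposite[s·t]≡+ (ω e false) (ω e true) (≡.trans (≡.sym (compat e)) positive) = opposite-⊛-inverse (ω e true) (f e)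

  edgeTerm-negativeLoop : ∀ f v e → sign e ≡ Sign.- →
                          edgeTerm Γ ω f v e ≈ onlyAt (end e false) v (ω e false ⊛ (f e ∙ f e))
  edgeTerm-negativeLoop f v e negative = trans (edgeTerm-loop f v e) (onlyAt-cong (end e false) v double)
    where
    double : ω e false ⊛ f e ∙ ω e true ⊛ f e ≈ ω e false ⊛ (f e ∙ f e)
    double rewrite opposite[s·t]≡- (ω e false) (ω e true) (≡.trans (≡.sym (compat e)) negative) = ⊛-∙ (ω e true) (f e) (f e)

  edgeTerm-elsewhere : ∀ f {v} e → end e false ≢ v → edgeTerm Γ ω f v e ≈ ε
  edgeTerm-elsewhere f {v} e e≢v = trans (edgeTerm-loop f v e) (reflexive (onlyAt-≢ _ e≢v))

  ∂-positive : ∀ f v → (∀ e → end e false ≡ v → sign e ≡ Sign.+) → ∂ Γ ω f v ≈ ε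
  ∂-positive f v positive = trans (∂≈∑edgeTerm Γ ω f v) (∑-ε _ term-ε)
    where
    term-ε : ∀ e → edgeTerm Γ ω f v e ≈ ε
    term-ε e = cases (end e false ≟ v)
      where
      cases : Dec (end e false ≡ v) → edgeTerm Γ ω f v e ≈ ε
      cases (yes at-v) = edgeTerm-positiveLoop f v e (positive e at-v)
      cases (no  e≢v)  = edgeTerm-elsewhere f e e≢v

module LoopFlowsStep {c ℓ} (G : AbelianGroup c ℓ) {n m : ℕ} (Γ : SignedGraph n (suc m))
       (loops : GraphOperations.AllLoops Γ) (ω : Orientation Γ) (compat : Compatible Γ ω) where

  open import Data.Fin using (zero; suc)
  open import Data.Fin.Properties using (_≟_)
  open import Data.Sign using () renaming (_*_ to _·_)
  open import Data.Product using (_,_)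
  open import Data.Product.Relation.Binary.Pointwise.NonDependent using (_×ₛ_)
  open import Data.Sum using (_⊎_; inj₁; inj₂)
  open import Data.Empty using (⊥-elim)
  open import Relation.Nullary using (¬_; yes; no)
  open import Relation.Binary.PropositionalEquality as ≡ using ()
  open import Data.Vec.Functional using (_∷_; removeAt)
  open import Function.Bundles using (Inverse)
  open SignedGraph Γ
  open GraphOperations
  open AbelianGroup G
  open GroupSums G
  open Boundary G
  open Cardinality using (count-cong; count-insert)
  open import Relation.Binary.Reasoning.Setoid setoid

  Γ₋ : SignedGraph n m
  Γ₋ = Γ ∖ zero

  ω₋ : Orientation Γ₋
  ω₋ = restrictOrientation Γ zero ω

  loops₋ : AllLoops Γ₋
  loops₋ e = loops (suc e)

  private
    module L  = LoopTerms G Γ  loops  ω  compat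
    module L₋ = LoopTerms G Γ₋ loops₋ ω₋ (restrict-compatible Γ zero ω compat)
    module N  = LoopGraph Γ  loops
    module N₋ = LoopGraph Γ₋ loops₋

  v₀ : Fin n
  v₀ = end zero false

  ∂-split : ∀ f v → ∂ Γ ω f v ≈ edgeTerm Γ ω f v zero ∙ ∂ Γ₋ ω₋ (removeAt f zero) v
  ∂-split = ∂-delete Γ ω zero

  ∂≈∂₋ : ∀ f v → edgeTerm Γ ω f v zero ≈ ε → ∂ Γ ω f v ≈ ∂ Γ₋ ω₋ (removeAt f zero) v
  ∂≈∂₋ f v term≈ε = trans (∂-split f v) (trans (∙-congʳ term≈ε) (identityˡ _))

  module Positive (positive : sign zero ≡ Sign.+) where

    flows-inverse : Inverse (FlowSetoid G Γ ω) (setoid ×ₛ FlowSetoid G Γ₋ ω₋)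
    flows-inverse = record
      { to = λ { (f , flow) → f zero , removeAt f zero , λ v → trans (sym (∂≈∂₋ f v (term≈ε f v))) (flow v) }
      ; from = λ { (x , f′ , flow′) → x ∷ f′ , λ v → trans (∂≈∂₋ _ v (term≈ε (x ∷ f′) v)) (flow′ v) }
      ; to-cong = λ f≈g → f≈g zero , λ e → f≈g (suc e)
      ; from-cong = λ { (x≈y , _) zero → x≈y ; (_ , f≈g) (suc e) → f≈g e }
      ; inverse = (λ f≈ → f≈ zero , λ e → f≈ (suc e)) , λ { (x≈ , _) zero → x≈ ; (_ , f≈) (suc e) → f≈ e } }
      where
      term≈ε : ∀ f v → edgeTerm Γ ω f v zero ≈ ε
      term≈ε f v = L.edgeTerm-positiveLoop f v zero positive

    negativeLoops-≡ : N.negativeLoops ≡ N₋.negativeLoops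
    negativeLoops-≡ = count-cong _ _ drop (λ { v (e , p) → suc e , p })
      where
      drop : ∀ v → N.NegativeLoopAt v → N₋.NegativeLoopAt v
      drop v (zero  , _ , negative) with ≡.trans (≡.sym positive) negative
      ... | ()
      drop v (suc e , p) = e , p

  module Negative (negative : sign zero ≡ Sign.-) where

    s₀ : Sign
    s₀ = ω zero false

    term≈ : ∀ f v → edgeTerm Γ ω f v zero ≈ onlyAt v₀ v (s₀ ⊛ (f zero ∙ f zero))
    term≈ f v = L.edgeTerm-negativeLoop f v zero negative

    module Unique (unique : ¬ N₋.NegativeLoopAt v₀) where

      ∂₋-v₀ : ∀ f′ → ∂ Γ₋ ω₋ f′ v₀ ≈ ε
      ∂₋-v₀ f′ = L₋.∂-positive f′ v₀ positive
        where
        positive : ∀ e → end (suc e) false ≡ v₀ → sign (suc e) ≡ Sign.+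
        positive e at-v₀ with sign (suc e) in eq
        ... | Sign.+ = ≡.refl
        ... | Sign.- = ⊥-elim (unique (e , at-v₀ , eq))

      term≈ε : ∀ f v → f zero ∙ f zero ≈ ε → edgeTerm Γ ω f v zero ≈ ε
      term≈ε f v torsion = trans (term≈ f v) (trans (onlyAt-cong v₀ v (trans (⊛-cong s₀ torsion) (⊛-ε s₀))) (onlyAt-ε v₀ v))

      torsion : ∀ f → IsFlow G Γ ω f → f zero ∙ f zero ≈ ε
      torsion f flow = ⊛≈ε⇒≈ε s₀ (begin
        s₀ ⊛ (f zero ∙ f zero)                        ≡⟨ onlyAt-≡ {x = v₀} _ ≡.refl ⟨
        onlyAt v₀ v₀ (s₀ ⊛ (f zero ∙ f zero))         ≈⟨ term≈ f v₀ ⟨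
        edgeTerm Γ ω f v₀ zero                        ≈⟨ identityʳ _ ⟨
        edgeTerm Γ ω f v₀ zero ∙ ε                    ≈⟨ ∙-congˡ (∂₋-v₀ (removeAt f zero)) ⟨
        edgeTerm Γ ω f v₀ zero ∙ ∂ Γ₋ ω₋ (removeAt f zero) v₀ ≈⟨ ∂-split f v₀ ⟨
        ∂ Γ ω f v₀                                    ≈⟨ flow v₀ ⟩
        ε                                             ∎)

      restrict-flow : ∀ f → IsFlow G Γ ω f → IsFlow G Γ₋ ω₋ (removeAt f zero)
      restrict-flow f flow v with v₀ ≟ v
      ... | yes ≡.refl = ∂₋-v₀ (removeAt f zero)
      ... | no  v₀≢v  = trans (sym (∂≈∂₋ f v (trans (term≈ f v) (reflexive (onlyAt-≢ _ v₀≢v))))) (flow v)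

      flows-inverse : Inverse (FlowSetoid G Γ ω) (TwoTorsion ×ₛ FlowSetoid G Γ₋ ω₋)
      flows-inverse = record
        { to = λ { (f , flow) → (f zero , torsion f flow) , removeAt f zero , restrict-flow f flow }
        ; from = λ { ((x , x+x≈ε) , f′ , flow′) →
                       x ∷ f′ , λ v → trans (∂≈∂₋ _ v (term≈ε (x ∷ f′) v x+x≈ε)) (flow′ v) }
        ; to-cong = λ f≈g → f≈g zero , λ e → f≈g (suc e)
        ; from-cong = λ { (x≈y , _) zero → x≈y ; (_ , f≈g) (suc e) → f≈g e }
        ; inverse = (λ f≈ → f≈ zero , λ e → f≈ (suc e)) , λ { (x≈ , _) zero → x≈ ; (_ , f≈) (suc e) → f≈ e } }

      negativeLoops-suc : N.negativeLoops ≡ suc N₋.negativeLoops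
      negativeLoops-suc = count-insert _ _ v₀ drop (λ { v (e , p) → suc e , p }) (zero , ≡.refl , negative) unique
        where
        drop : ∀ v → N.NegativeLoopAt v → N₋.NegativeLoopAt v ⊎ v ≡ v₀
        drop v (zero  , at-v , _) = inj₂ (≡.sym at-v)
        drop v (suc e , p)        = inj₁ (e , p)

    -- A second negative loop j at v₀ absorbs the contribution of loop 0 at v₀ (by shearing its
    -- value onto j), so the value on loop 0 is free.
    module Repeated (j : Fin m) (j-at-v₀ : end (suc j) false ≡ v₀) (j-negative : sign (suc j) ≡ Sign.-) where

      s₁ t : Sign
      s₁ = ω (suc j) false
      t  = s₁ · s₀

      δ : Carrier → Fin m → Carrier
      δ d e = onlyAt e j d

      ∂₋-δ : ∀ d v → ∂ Γ₋ ω₋ (δ d) v ≈ onlyAt v₀ v (s₁ ⊛ (d ∙ d))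
      ∂₋-δ d v = begin
        ∂ Γ₋ ω₋ (δ d) v                          ≈⟨ ∂≈∑edgeTerm Γ₋ ω₋ (δ d) v ⟩
        ∑ (edgeTerm Γ₋ ω₋ (δ d) v)               ≈⟨ ∑-single j _ (λ e e≢j → edgeTerm-ε Γ₋ ω₋ (δ d) v e (reflexive (onlyAt-≢ d e≢j))) ⟩
        edgeTerm Γ₋ ω₋ (δ d) v j                 ≈⟨ L₋.edgeTerm-negativeLoop (δ d) v j j-negative ⟩
        onlyAt (end (suc j) false) v (s₁ ⊛ (δ d j ∙ δ d j)) ≡⟨ ≡.cong₂ (λ x y → onlyAt x v (s₁ ⊛ (y ∙ y))) j-at-v₀ (onlyAt-≡ {x = j} d ≡.refl) ⟩
        onlyAt v₀ v (s₁ ⊛ (d ∙ d))               ∎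

      term≈∂₋-δ : ∀ f v → edgeTerm Γ ω f v zero ≈ ∂ Γ₋ ω₋ (δ (t ⊛ f zero)) v
      term≈∂₋-δ f v = begin
        edgeTerm Γ ω f v zero                         ≈⟨ term≈ f v ⟩
        onlyAt v₀ v (s₀ ⊛ (f zero ∙ f zero))          ≈⟨ onlyAt-cong v₀ v sheared ⟩
        onlyAt v₀ v (s₁ ⊛ (t ⊛ f zero ∙ t ⊛ f zero))  ≈⟨ ∂₋-δ (t ⊛ f zero) v ⟨
        ∂ Γ₋ ω₋ (δ (t ⊛ f zero)) v                    ∎
        where
        sheared : s₀ ⊛ (f zero ∙ f zero) ≈ s₁ ⊛ (t ⊛ f zero ∙ t ⊛ f zero)
        sheared = begin
          s₀ ⊛ (f zero ∙ f zero)           ≈⟨ ⊛-involutive s₁ _ ⟨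
          s₁ ⊛ s₁ ⊛ s₀ ⊛ (f zero ∙ f zero) ≈⟨ ⊛-cong s₁ (⊛-· s₁ s₀ _) ⟨
          s₁ ⊛ t ⊛ (f zero ∙ f zero)       ≈⟨ ⊛-cong s₁ (⊛-∙ t _ _) ⟨
          s₁ ⊛ (t ⊛ f zero ∙ t ⊛ f zero)   ∎

      shear : Carrier → (Fin m → Carrier) → Fin m → Carrier
      shear d f′ e = f′ e ∙ δ d e

      shear-cong : ∀ {d d′ f′ g′} → d ≈ d′ → (∀ e → f′ e ≈ g′ e) → ∀ e → shear d f′ e ≈ shear d′ g′ e
      shear-cong d≈d′ f′≈g′ e = ∙-cong (f′≈g′ e) (onlyAt-cong e j d≈d′)

      shear-cancel : ∀ {d d′} f′ → d ∙ d′ ≈ ε → ∀ e → shear d′ (shear d f′) e ≈ f′ e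
      shear-cancel {d} {d′} f′ d+d′≈ε e = begin
        (f′ e ∙ δ d e) ∙ δ d′ e  ≈⟨ assoc _ _ _ ⟩
        f′ e ∙ (δ d e ∙ δ d′ e)  ≈⟨ ∙-congˡ (onlyAt-∙ e j d d′) ⟨
        f′ e ∙ onlyAt e j (d ∙ d′) ≈⟨ ∙-congˡ (trans (onlyAt-cong e j d+d′≈ε) (onlyAt-ε e j)) ⟩
        f′ e ∙ ε                 ≈⟨ identityʳ _ ⟩
        f′ e                     ∎

      ∂-shear : ∀ f v → ∂ Γ ω f v ≈ ∂ Γ₋ ω₋ (shear (t ⊛ f zero) (removeAt f zero)) v
      ∂-shear f v = begin
        ∂ Γ ω f v                                                        ≈⟨ ∂-split f v ⟩
        edgeTerm Γ ω f v zero ∙ ∂ Γ₋ ω₋ (removeAt f zero) v              ≈⟨ ∙-congʳ (term≈∂₋-δ f v) ⟩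
        ∂ Γ₋ ω₋ (δ (t ⊛ f zero)) v ∙ ∂ Γ₋ ω₋ (removeAt f zero) v         ≈⟨ comm _ _ ⟩
        ∂ Γ₋ ω₋ (removeAt f zero) v ∙ ∂ Γ₋ ω₋ (δ (t ⊛ f zero)) v         ≈⟨ ∂-∙ Γ₋ ω₋ (removeAt f zero) (δ (t ⊛ f zero)) v ⟨
        ∂ Γ₋ ω₋ (shear (t ⊛ f zero) (removeAt f zero)) v                 ∎

      unshear : Carrier → (Fin m → Carrier) → Fin (suc m) → Carrier
      unshear x f′ = x ∷ shear ((t ⊛ x) ⁻¹) f′

      flows-inverse : Inverse (FlowSetoid G Γ ω) (setoid ×ₛ FlowSetoid G Γ₋ ω₋)
      flows-inverse = record
        { to = λ { (f , flow) →
                     f zero , shear (t ⊛ f zero) (removeAt f zero) , λ v → trans (sym (∂-shear f v)) (flow v) }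
        ; from = λ { (x , f′ , flow′) →
                       unshear x f′ , λ v → trans (∂-shear (unshear x f′) v)
                                                  (trans (∂-cong Γ₋ ω₋ (shear-cancel f′ (inverseˡ (t ⊛ x))) v) (flow′ v)) }
        ; to-cong = λ f≈g → f≈g zero , shear-cong (⊛-cong t (f≈g zero)) (λ e → f≈g (suc e))
        ; from-cong = λ { (x≈y , _) zero → x≈y ; (x≈y , f≈g) (suc e) → shear-cong (⁻¹-cong (⊛-cong t x≈y)) f≈g e }
        ; inverse = (λ { {x , f′ , _} f≈ →
                         f≈ zero , λ e → trans (shear-cong (⊛-cong t (f≈ zero)) (λ e → f≈ (suc e)) e)
                                               (shear-cancel f′ (inverseˡ (t ⊛ x)) e) })
                  , (λ { (x≈ , _) zero → x≈
                       ; {f , _} (x≈ , f≈) (suc e) → trans (shear-cong (⁻¹-cong (⊛-cong t x≈)) f≈ e)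
                                                           (shear-cancel (removeAt f zero) (inverseʳ (t ⊛ f zero)) e) }) }

      negativeLoops-≡ : N.negativeLoops ≡ N₋.negativeLoops
      negativeLoops-≡ = count-cong _ _ drop (λ { v (e , p) → suc e , p })
        where
        drop : ∀ v → N.NegativeLoopAt v → N₋.NegativeLoopAt v
        drop v (zero  , at-v , _) = j , ≡.trans j-at-v₀ at-v , j-negative
        drop v (suc e , p)        = e , p

module LoopFlowCount {c ℓ} (G : AbelianGroup c ℓ) {g h : ℕ}
       (card : HasCard (AbelianGroup.setoid G) g) (card₂ : HasCard (TwoG G) h) where

  open import Level using (_⊔_)
  open import Data.Nat using (zero; suc)
  open import Data.Fin using (zero)
  open import Data.Product using (∃; _×_; _,_)
  open import Relation.Nullary using (yes; no)
  open import Relation.Binary.PropositionalEquality as ≡ using (cong; trans; sym)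
  import Function.Construct.Composition as Comp
  open import Data.Nat.Solver using (module +-*-Solver)
  open +-*-Solver using (solve; _:*_; _:=_)
  open AbelianGroup G using (setoid; refl)
  open Cardinality
  open Halving G card using (HasCard-TwoTorsion; card-decomposition)
  open GraphOperations using (AllLoops; restrict-compatible)

  HasCard-no-edges : ∀ {n} (Γ : SignedGraph n 0) (ω : Orientation Γ) → HasCard (FlowSetoid G Γ ω) 1
  HasCard-no-edges Γ ω = record
    { to = λ _ → zero ; from = λ _ → (λ ()) , (λ v → refl)
    ; to-cong = λ _ → ≡.refl ; from-cong = λ _ ()
    ; inverse = (λ { {zero} _ → ≡.refl }) , (λ _ ()) }

  private
    scale : ∀ g N′ x y → N′ * x ≡ y → (g * N′) * x ≡ g * y
    scale g N′ x y eq = trans (solve 3 (λ g N x → (g :* N) :* x := g :* (N :* x)) ≡.refl g N′ x) (cong (g *_) eq)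

    scale₂ : ∀ t h N′ x y → N′ * x ≡ y → (t * N′) * (h * x) ≡ (t * h) * y
    scale₂ t h N′ x y eq = trans (solve 4 (λ t h N x → (t :* N) :* (h :* x) := (t :* h) :* (N :* x)) ≡.refl t h N′ x)
                                 (cong ((t * h) *_) eq)

  CountedFlows : ∀ {n m} (Γ : SignedGraph n m) → AllLoops Γ → Orientation Γ → Set (c ⊔ ℓ)
  CountedFlows {m = m} Γ loops ω =
    ∃ λ N → HasCard (FlowSetoid G Γ ω) N × N * h ^ LoopGraph.negativeLoops Γ loops ≡ g ^ m

  loop-flow-count : ∀ {n} m (Γ : SignedGraph n m) (loops : AllLoops Γ) (ω : Orientation Γ) → Compatible Γ ω →
                    CountedFlows Γ loops ω
  loop-flow-count zero Γ loops ω compat =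
    1 , HasCard-no-edges Γ ω , cong (λ k → 1 * h ^ k) (count-∅ (LoopGraph.negativeLoopAt? Γ loops) (λ { v (() , _) }))
  loop-flow-count (suc m) Γ loops ω compat =
    extend (loop-flow-count m Γ₋ loops₋ ω₋ (restrict-compatible Γ zero ω compat)) (SignedGraph.sign Γ zero) ≡.refl
    where
    open LoopFlowsStep G Γ loops ω compat
    extend : CountedFlows Γ₋ loops₋ ω₋ → ∀ s → SignedGraph.sign Γ zero ≡ s → CountedFlows Γ loops ω
    extend (N′ , card′ , eq′) Sign.+ sign₀ =
      g * N′ , Comp.inverse (Positive.flows-inverse sign₀) (HasCard-× card card′) ,
      trans (cong (λ k → (g * N′) * h ^ k) (Positive.negativeLoops-≡ sign₀)) (scale g N′ _ _ eq′)
    extend (N′ , card′ , eq′) Sign.- sign₀ with LoopGraph.negativeLoopAt? Γ₋ loops₋ v₀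
    ... | yes (j , j-at-v₀ , j-negative) =
      g * N′ , Comp.inverse (Repeated.flows-inverse j j-at-v₀ j-negative) (HasCard-× card card′) ,
      trans (cong (λ k → (g * N′) * h ^ k) (Repeated.negativeLoops-≡ j j-at-v₀ j-negative)) (scale g N′ _ _ eq′)
      where open Negative sign₀
    ... | no unique with HasCard-TwoTorsion
    ...   | t , card-t =
      t * N′ , Comp.inverse (Unique.flows-inverse unique) (HasCard-× card-t card′) ,
      trans (cong (λ k → (t * N′) * h ^ k) (Unique.negativeLoops-suc unique))
            (trans (scale₂ t h N′ _ _ eq′) (cong (_* g ^ m) (sym (card-decomposition card-t card₂))))
      where open Negative sign₀

module SwitchContract {n m : ℕ} (Γ : SignedGraph (suc n) (suc m)) (e₀ : Fin (suc m))
       (a≢b : SignedGraph.end Γ e₀ false ≢ SignedGraph.end Γ e₀ true)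
       (ω : Orientation Γ) (compat : Compatible Γ ω) where

  open import Data.Fin.Properties using (_≟_)
  open import Data.Sign using () renaming (_*_ to _·_)
  open import Data.Sign.Properties using (s*s≡+)
  open import Data.Empty using (⊥-elim)
  open import Relation.Nullary using (yes; no)
  open import Relation.Binary.PropositionalEquality using (refl; trans; cong₂)
  open import Function.Bundles using (Inverse)
  import Function.Construct.Composition as Comp
  open SignedGraph Γ
  open GraphOperations

  τ : Fin (suc n) → Sign
  τ v with v ≟ end e₀ true
  ... | yes _ = sign e₀
  ... | no  _ = Sign.+

  Γˢ : SignedGraph (suc n) (suc m)
  Γˢ = switch Γ τ

  e₀-positive : SignedGraph.sign Γˢ e₀ ≡ Sign.+
  e₀-positive = trans (cong₂ (λ x y → sign e₀ · (x · y)) τ-a τ-b) (s*s≡+ (sign e₀))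
    where
    τ-a : τ (end e₀ false) ≡ Sign.+
    τ-a with end e₀ false ≟ end e₀ true
    ... | yes a≡b = ⊥-elim (a≢b a≡b)
    ... | no  _   = refl
    τ-b : τ (end e₀ true) ≡ sign e₀
    τ-b with end e₀ true ≟ end e₀ true
    ... | yes _   = refl
    ... | no  b≢b = ⊥-elim (b≢b refl)

  private
    ωˢ : Orientation Γˢ
    ωˢ = switchOrientation Γ τ ω
    module S = Switching Γ τ
    module B = ContractionBalance Γˢ e₀ a≢b e₀-positive

  open Contraction Γˢ e₀ a≢b public using (Γ′)

  ω′ : Orientation Γ′
  ω′ = restrictOrientation Γˢ e₀ ωˢ

  compatible′ : Compatible Γ′ ω′
  compatible′ = restrict-compatible Γˢ e₀ ωˢ (S.switch-compatible ω compat)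

  flows-inverse : ∀ {c ℓ} (G : AbelianGroup c ℓ) → Inverse (FlowSetoid G Γ ω) (FlowSetoid G Γ′ ω′)
  flows-inverse G = Comp.inverse (S.switch-flows-inverse G ω)
                                 (ContractionFlows.flows-inverse Γˢ e₀ a≢b e₀-positive G ωˢ (S.switch-compatible ω compat))

  module _ (dichotomy′ : Cycles.BalanceDichotomy Γ′) where

    dichotomy : Cycles.BalanceDichotomy Γ
    dichotomy = S.dichotomy-to (B.dichotomy-lift dichotomy′)

    balancedComps-inverse : Inverse (BalancedComps Γ) (BalancedComps Γ′)
    balancedComps-inverse = Comp.inverse S.balancedComps-inverse (B.balancedComps-inverse dichotomy′)

    unbalancedComps-inverse : Inverse (UnbalancedComps Γ) (UnbalancedComps Γ′)
    unbalancedComps-inverse = Comp.inverse S.unbalancedComps-inverse (B.unbalancedComps-inverse dichotomy′)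

module FlowCount {c ℓ} (G : AbelianGroup c ℓ) {g h : ℕ}
       (card : HasCard (AbelianGroup.setoid G) g) (card₂ : HasCard (TwoG G) h) where

  open import Level using (_⊔_)
  open import Data.Nat using (zero; suc)
  open import Data.Nat.Properties using (^-distribˡ-+-*)
  open import Data.Fin.Properties using (_≟_; any?)
  open import Data.Product using (_×_; _,_)
  open import Relation.Nullary using (yes; no; ¬?)
  open import Relation.Nullary.Decidable using (decidable-stable)
  open import Relation.Binary using (Setoid)
  open import Function.Bundles using (Inverse)
  open import Relation.Binary.PropositionalEquality as ≡ using (refl; cong; sym)
  import Function.Construct.Composition as Comp
  import Function.Construct.Symmetry as Sym
  open import Data.Nat.Solver using (module +-*-Solver)
  open +-*-Solver using (solve; _:*_; _:=_)
  open Cardinality using (HasCard-unique)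
  open LoopFlowCount G card card₂ using (loop-flow-count)
  open GraphOperations using (AllLoops)

  FlowFormula : ∀ {n m} (Γ : SignedGraph n m) → Orientation Γ → Set (c ⊔ ℓ)
  FlowFormula {n} {m} Γ ω = ∀ N kb ku →
    HasCard (FlowSetoid G Γ ω) N → HasCard (BalancedComps Γ) kb → HasCard (UnbalancedComps Γ) ku →
    N * g ^ n * h ^ ku ≡ g ^ (m + kb) * g ^ ku

  loop-formula : ∀ {n m} (Γ : SignedGraph n m) (loops : AllLoops Γ) (ω : Orientation Γ) → Compatible Γ ω →
                 FlowFormula Γ ω
  loop-formula {n} {m} Γ loops ω compat N kb ku card-N card-kb card-ku with loop-flow-count m Γ loops ω compat
  ... | N₀ , card-N₀ , N₀-formula = begin
    N * g ^ n * h ^ ku                  ≡⟨ ≡.cong₂ (λ x y → x * g ^ n * h ^ y) N≡N₀ ku≡c′ ⟩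
    N₀ * g ^ n * h ^ c′                 ≡⟨ cong (λ x → N₀ * g ^ x * h ^ c′) (sym kb+c′≡n) ⟩
    N₀ * g ^ (kb + c′) * h ^ c′         ≡⟨ cong (λ x → N₀ * x * h ^ c′) (^-distribˡ-+-* g kb c′) ⟩
    N₀ * (g ^ kb * g ^ c′) * h ^ c′     ≡⟨ solve 4 (λ N x y z → N :* (x :* y) :* z := (N :* z) :* x :* y) refl N₀ (g ^ kb) (g ^ c′) (h ^ c′) ⟩
    N₀ * h ^ c′ * g ^ kb * g ^ c′       ≡⟨ cong (λ x → x * g ^ kb * g ^ c′) N₀-formula ⟩
    g ^ m * g ^ kb * g ^ c′             ≡⟨ cong (_* g ^ c′) (^-distribˡ-+-* g m kb) ⟨
    g ^ (m + kb) * g ^ c′               ≡⟨ cong (λ x → g ^ (m + kb) * g ^ x) ku≡c′ ⟨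
    g ^ (m + kb) * g ^ ku               ∎
    where
    open ≡.≡-Reasoning
    c′ : ℕ
    c′ = LoopGraph.negativeLoops Γ loops
    N≡N₀ : N ≡ N₀
    N≡N₀ = HasCard-unique card-N card-N₀
    ku≡c′ : ku ≡ c′
    ku≡c′ = LoopGraph.unbalancedComps-count Γ loops card-ku
    kb+c′≡n : kb + c′ ≡ n
    kb+c′≡n = LoopGraph.balancedComps-count Γ loops card-kb

  contraction-formula : ∀ {n m} (Γ : SignedGraph (suc n) (suc m)) e₀ a≢b (ω : Orientation Γ) (compat : Compatible Γ ω) →
                        let module SC = SwitchContract Γ e₀ a≢b ω compat in
                        (dichotomy′ : Cycles.BalanceDichotomy SC.Γ′) → FlowFormula SC.Γ′ SC.ω′ → FlowFormula Γ ω
  contraction-formula {n} {m} Γ e₀ a≢b ω compat dichotomy′ formula′ N kb ku card-N card-kb card-ku = begin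
    N * (g * g ^ n) * h ^ ku       ≡⟨ solve 4 (λ N g x y → N :* (g :* x) :* y := g :* (N :* x :* y)) refl N g (g ^ n) (h ^ ku) ⟩
    g * (N * g ^ n * h ^ ku)       ≡⟨ cong (g *_) (formula′ N kb ku (transport (SC.flows-inverse G) card-N)
                                                         (transport (SC.balancedComps-inverse dichotomy′) card-kb)
                                                         (transport (SC.unbalancedComps-inverse dichotomy′) card-ku)) ⟩
    g * (g ^ (m + kb) * g ^ ku)    ≡⟨ solve 3 (λ g x y → g :* (x :* y) := (g :* x) :* y) refl g (g ^ (m + kb)) (g ^ ku) ⟩
    g * g ^ (m + kb) * g ^ ku      ∎
    where
    module SC = SwitchContract Γ e₀ a≢b ω compat
    open ≡.≡-Reasoning
    transport : ∀ {a b ℓa ℓb} {A : Setoid a ℓa} {B : Setoid b ℓb} {k} → Inverse A B → HasCard A k → HasCard B k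
    transport I = Comp.inverse (Sym.inverse I)

  flow-formula : ∀ m {n} (Γ : SignedGraph n m) (ω : Orientation Γ) → Compatible Γ ω →
                 Cycles.BalanceDichotomy Γ × FlowFormula Γ ω
  flow-formula m Γ ω compat with any? (λ e → ¬? (SignedGraph.end Γ e false ≟ SignedGraph.end Γ e true))
  ... | no no-link = LoopGraph.dichotomy Γ loops , loop-formula Γ loops ω compat
    where
    loops : AllLoops Γ
    loops e = decidable-stable (SignedGraph.end Γ e false ≟ SignedGraph.end Γ e true) (λ a≢b → no-link (e , a≢b))
  flow-formula (suc m) {suc n} Γ ω compat | yes (e₀ , a≢b) with flow-formula m SC.Γ′ SC.ω′ SC.compatible′
    where module SC = SwitchContract Γ e₀ a≢b ω compat
  ... | dichotomy′ , formula′ =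
    SwitchContract.dichotomy Γ e₀ a≢b ω compat dichotomy′ , contraction-formula Γ e₀ a≢b ω compat dichotomy′ formula′
  flow-formula (suc m) {zero} Γ ω compat | yes (e₀ , _) with SignedGraph.end Γ e₀ false
  ... | ()

theorem5p1 : ∀ {c ℓ} (G : AbelianGroup c ℓ) (g h : ℕ) →
    HasCard (AbelianGroup.setoid G) g → HasCard (TwoG G) h →
    ∀ {n m : ℕ} (Γ : SignedGraph n m) (ω : Orientation Γ) → Compatible Γ ω →
    ∀ (N kb ku : ℕ) →
    HasCard (FlowSetoid G Γ ω) N →
    HasCard (BalancedComps Γ) kb →
    HasCard (UnbalancedComps Γ) ku →
    N * g ^ n * h ^ ku ≡ g ^ (m + kb) * g ^ ku
theorem5p1 G g h card card₂ {m = m} Γ ω compat = proj₂ (FlowCount.flow-formula G card card₂ m Γ ω compat)
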